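{- For all $n \geq 0$, $$p_o(n)+\sum_{j\ge1}(-1)^j\Big(p_o\big(n-j(3j-2)\big)+p_o\big(n-j(3j+2)\big)\Big) = p_o(n)-p_o(n-1)-p_o(n-5)+p_o(n-8)+p_o(n-16)-\cdots = \begin{cases}1, & \text{if } n = 3\cdot k(k+1)/2 \text{ for some integer } k\ge0,\\ 0, & \text{otherwise.}\end{cases}$$
   Context: $p_o(n)$ denotes the number of partitions of $n$ into odd parts, with $p_o(0)=1$ and $p_o(m)=0$ for $m<0$. -}

module Defs where

import Data.Nat
open import Data.Nat using (ℕ; zero; suc; _+_; _*_; _∸_; _≤_; _<_; _≤?_)
open import Data.List using (List; []; _∷_; length; concatMap; map; upTo)
open import Data.Integer as ℤ using (ℤ; +_; -[1+_])
open import Relation.Nullary.Decidable using (does)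
open import Data.Bool using (if_then_else_)
open import Data.Product using (∃)
open import Relation.Binary.PropositionalEquality using (_≡_)

-- All partitions of n into odd parts, each part ≤ 2b+1, as non-increasing lists
-- of (odd) parts.  Fuel f ≥ n guarantees termination.
oddPartsBounded : ℕ → ℕ → ℕ → List (List ℕ)
oddPartsBounded zero    zero    b = [] ∷ []
oddPartsBounded zero    (suc n) b = []
oddPartsBounded (suc f) zero    b = [] ∷ []
oddPartsBounded (suc f) (suc n) b =
  concatMap (λ i → let part = 2 * i + 1 in
                   if does (part ≤? suc n)
                   then map (part ∷_) (oddPartsBounded f (suc n ∸ part) i)
                   else [])
            (upTo (suc b))

oddPartitions : ℕ → List (List ℕ)
oddPartitions n = oddPartsBounded n n n

po : ℕ → ℕ
po n = length (oddPartitions n)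

poℤ : ℤ → ℤ
poℤ (+ n)     = + po n
poℤ -[1+ n ]  = + 0

sign : ℕ → ℤ
sign zero          = + 1
sign (suc zero)    = ℤ.- (+ 1)
sign (suc (suc j)) = sign j

term : ℕ → ℕ → ℤ
term n j = sign j ℤ.* (poℤ (+ n ℤ.- (+ j ℤ.* (+ (3 * j) ℤ.- + 2)))
                      ℤ.+ poℤ (+ n ℤ.- + (j * (3 * j + 2))))

sumTerms : ℕ → ℕ → ℤ
sumTerms n zero    = + 0
sumTerms n (suc N) = sumTerms n N ℤ.+ term n (suc N)

-- The full series: terms with j > n vanish (j(3j-2) ≥ j > n), so summing
-- j = 1 .. n+1 gives the whole sum over j ≥ 1.
lhs : ℕ → ℤ
lhs n = poℤ (+ n) ℤ.+ sumTerms n (suc n)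

IsThreeTri : ℕ → Set
IsThreeTri n = ∃ λ k → 2 * n ≡ 3 * (k * suc k)

private
  open import Relation.Binary.PropositionalEquality using (refl)
  t1 : Data.List.map po (upTo 12) ≡ 1 ∷ 1 ∷ 1 ∷ 2 ∷ 2 ∷ 3 ∷ 4 ∷ 5 ∷ 6 ∷ 8 ∷ 10 ∷ 12 ∷ []
  t1 = refl
  t2 : Data.List.map lhs (upTo 20) ≡ Data.List.map (λ n → if does (n Data.Nat.≟ 0) then + 1 else if does (n Data.Nat.≟ 3) then + 1 else if does (n Data.Nat.≟ 9) then + 1 else if does (n Data.Nat.≟ 18) then + 1 else + 0) (upTo 20)
  t2 = refl

module Submission where

-- In generating functions, with θ(q) = Σ_{j∈ℤ} (-1)ʲ q^{j(3j+2)} and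
-- Σ p_o(n) qⁿ = 1 / ∏_{i≥0} (1 - q^{2i+1}) (Euler), the claim is
--   θ(q) = ∏ (1 - q^{2i+1}) · Σ_{k≥0} q^{3k(k+1)/2}.
-- Both sides are products by the Jacobi triple product:
--   θ(q)               = (q⁶; q⁶)_∞ ∏ (1 - q^{6i+1}) (1 - q^{6i+5}),
--   Σ q^{3k(k+1)/2}    = (q¹²; q¹²)_∞ ∏ (1 + q^{12i+3}) (1 + q^{12i+9}),
-- and the two products agree after multiplication by ∏ (1 - q^{2i+1}), using
-- (1 - q^{12i+3})(1 + q^{12i+3}) = 1 - q^{24i+6} and likewise for 12i + 9.
--
-- Series are functions ℤ → ℤ; infinite products are replaced by finite ones, which agree
-- with the infinite ones up to a given degree.

open import Defs
open import Data.Nat as ℕ using (ℕ; zero; suc)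
import Data.Nat.Properties as ℕP
import Data.Nat.Tactic.RingSolver as ℕSolver
open import Data.Integer as ℤ using (ℤ; +_; -[1+_]; _+_; _-_; _*_; -_; _≤_; _<_; _^_)
import Data.Integer.Properties as ℤP
open import Data.Integer.Tactic.RingSolver using (solve-∀)
open import Data.Product using (_×_; _,_; ∃)
open import Data.List using (List; []; _∷_; _++_; length; map; upTo; concatMap)
import Data.List.Properties as ListP
import Data.List.Relation.Binary.Permutation.Propositional as Perm
open Perm using (_↭_; ↭-sym; ↭-trans; ↭-reflexive)
import Data.List.Relation.Binary.Permutation.Propositional.Properties as PermP
open import Data.Nat.ListAction using (sum)
import Data.Nat.ListAction.Properties as SumP
open import Data.Bool using (Bool; true; false; if_then_else_)
open import Data.Sum using (inj₁; inj₂)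
open import Data.Empty using (⊥-elim)
open import Relation.Nullary using (¬_; yes; no; does)
open import Relation.Nullary.Decidable using (dec-true; dec-false)
open import Relation.Binary.PropositionalEquality
open ≡-Reasoning

-- A series f : ℤ → ℤ stands for the formal Laurent series Σₓ f x · qˣ.
Series : Set
Series = ℤ → ℤ

infix 4 _≈_
_≈_ : Series → Series → Set
f ≈ g = ∀ x → f x ≡ g x

≈-refl : ∀ {f} → f ≈ f
≈-refl x = refl

≈-sym : ∀ {f g} → f ≈ g → g ≈ f
≈-sym p x = sym (p x)

≈-trans : ∀ {f g h} → f ≈ g → g ≈ h → f ≈ h
≈-trans p q x = trans (p x) (q x)

one : Series
one (+ zero)  = + 1
one (+ suc _) = + 0
one -[1+ _ ]  = + 0

mulBy : ℤ → ℕ → Series → Series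
mulBy e a f x = f x - e * f (x - + a)

-- A factor (e , a) stands for the binomial 1 - e qᵃ; a list of factors for their product.
Factor : Set
Factor = ℤ × ℕ

mulAll : List Factor → Series → Series
mulAll []            f = f
mulAll ((e , a) ∷ L) f = mulBy e a (mulAll L f)

mulBy-cong : ∀ e a {f g} → f ≈ g → mulBy e a f ≈ mulBy e a g
mulBy-cong e a p x = cong₂ (λ u v → u - e * v) (p x) (p (x - + a))

mulAll-cong : ∀ L {f g} → f ≈ g → mulAll L f ≈ mulAll L g
mulAll-cong []            p = p
mulAll-cong ((e , a) ∷ L) p = mulBy-cong e a (mulAll-cong L p)

mulBy-comm : ∀ e a e' b f → mulBy e a (mulBy e' b f) ≈ mulBy e' b (mulBy e a f)
mulBy-comm e a e' b f x =
  trans (cong (λ y → (f x - e' * f (x - + b)) - e * (f (x - + a) - e' * f y)) (swap x (+ a) (+ b)))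
        (expand e e' (f x) (f (x - + b)) (f (x - + a)) (f (x - + b - + a)))
  where
  swap : ∀ (x a b : ℤ) → x - a - b ≡ x - b - a
  swap = solve-∀
  expand : ∀ (e e' u v w z : ℤ) → (u - e' * v) - e * (w - e' * z) ≡ (u - e * w) - e' * (v - e * z)
  expand = solve-∀

mulBy-mulAll : ∀ e a L f → mulBy e a (mulAll L f) ≈ mulAll L (mulBy e a f)
mulBy-mulAll e a []             f = ≈-refl
mulBy-mulAll e a ((e' , b) ∷ L) f =
  ≈-trans (mulBy-comm e a e' b (mulAll L f)) (mulBy-cong e' b (mulBy-mulAll e a L f))

mulAll-++ : ∀ L M f → mulAll (L ++ M) f ≈ mulAll L (mulAll M f)
mulAll-++ []            M f = ≈-refl
mulAll-++ ((e , a) ∷ L) M f = mulBy-cong e a (mulAll-++ L M f)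

mulBy-square : ∀ a b f → a ℕ.+ a ≡ b → mulBy (+ 1) a (mulBy (- + 1) a f) ≈ mulBy (+ 1) b f
mulBy-square a b f refl x =
  trans (cong (λ y → (f x - (- + 1) * f (x - + a)) - + 1 * (f (x - + a) - (- + 1) * f y))
              (trans (twice x (+ a)) (cong (λ t → x - t) (sym (ℤP.pos-+ a a)))))
        (expand (f x) (f (x - + a)) (f (x - + (a ℕ.+ a))))
  where
  twice : ∀ (x a : ℤ) → x - a - a ≡ x - (a + a)
  twice = solve-∀
  expand : ∀ (u v w : ℤ) → (u - (- + 1) * v) - + 1 * (v - (- + 1) * w) ≡ u - + 1 * w
  expand = solve-∀

mulAll-scale-shift : ∀ L (k a : ℤ) (g : Series) → mulAll L (λ x → k * g (x - a)) ≈ (λ x → k * mulAll L g (x - a))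
mulAll-scale-shift []            k a g = ≈-refl
mulAll-scale-shift ((e , b) ∷ L) k a g x =
  trans (mulBy-cong e b (mulAll-scale-shift L k a g) x)
  (trans (cong (λ y → k * G (x - a) - e * (k * G y)) (swap x a (+ b)))
         (factor-out k e (G (x - a)) (G (x - a - + b))))
  where
  G : Series
  G = mulAll L g
  swap : ∀ (x a b : ℤ) → x - b - a ≡ x - a - b
  swap = solve-∀
  factor-out : ∀ (k e v w : ℤ) → k * v - e * (k * w) ≡ k * (v - e * w)
  factor-out = solve-∀

record IsPowerSeries (f : Series) : Set where
  constructor powerSeries
  field negative-zero : ∀ n → f -[1+ n ] ≡ + 0
open IsPowerSeries public

vanish : ∀ {f} → IsPowerSeries f → ∀ {x} → x < + 0 → f x ≡ + 0
vanish p {+ n}      (ℤ.+<+ ())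
vanish p { -[1+ n ]} _ = negative-zero p n

one-power : IsPowerSeries one
one-power = powerSeries λ n → refl

shift-neg : ∀ {x d a} → x ≤ d → d < a → x - a < + 0
shift-neg {x} {d} {a} x≤d d<a =
  subst (x - a <_) (ℤP.+-inverseʳ a) (ℤP.+-monoˡ-< (- a) (ℤP.≤-<-trans x≤d d<a))

shift-le : ∀ {x d} a → x ≤ d → x - + a ≤ d
shift-le a x≤d = ℤP.i≤j⇒i-k≤j (+ a) x≤d

shift-le-nonneg : ∀ {x d a} → + 0 ≤ a → x ≤ d → x - a ≤ d
shift-le-nonneg (ℤ.+≤+ {n = a} _) x≤d = shift-le a x≤d

mulBy-power : ∀ e a {f} → IsPowerSeries f → IsPowerSeries (mulBy e a f)
mulBy-power e a {f} p = powerSeries λ n → begin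
  f -[1+ n ] - e * f (-[1+ n ] - + a) ≡⟨ cong₂ (λ u v → u - e * v) (negative-zero p n) (vanish p (shift-neg {a = + a} ℤP.≤-refl ℤ.-<+)) ⟩
  + 0 - e * + 0                       ≡⟨ cong (λ t → + 0 - t) (ℤP.*-zeroʳ e) ⟩
  + 0                                 ∎

mulAll-power : ∀ L {f} → IsPowerSeries f → IsPowerSeries (mulAll L f)
mulAll-power []            p = p
mulAll-power ((e , a) ∷ L) p = mulBy-power e a (mulAll-power L p)

infix 4 _≈[_]_
_≈[_]_ : Series → ℤ → Series → Set
f ≈[ d ] g = ∀ x → x ≤ d → f x ≡ g x

≈⇒≈[] : ∀ {f g} d → f ≈ g → f ≈[ d ] g
≈⇒≈[] d p x _ = p x

≈[]-sym : ∀ {f g d} → f ≈[ d ] g → g ≈[ d ] f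
≈[]-sym p x x≤d = sym (p x x≤d)

≈[]-trans : ∀ {f g h d} → f ≈[ d ] g → g ≈[ d ] h → f ≈[ d ] h
≈[]-trans p q x x≤d = trans (p x x≤d) (q x x≤d)

≈[]-mono : ∀ {f g d d'} → d' ≤ d → f ≈[ d ] g → f ≈[ d' ] g
≈[]-mono d'≤d p x x≤d' = p x (ℤP.≤-trans x≤d' d'≤d)

-- Multiplying by a power series only looks at lower coefficients.
mulBy-cong[] : ∀ e a {f g d} → f ≈[ d ] g → mulBy e a f ≈[ d ] mulBy e a g
mulBy-cong[] e a p x x≤d = cong₂ (λ u v → u - e * v) (p x x≤d) (p (x - + a) (shift-le a x≤d))

mulAll-cong[] : ∀ L {f g d} → f ≈[ d ] g → mulAll L f ≈[ d ] mulAll L g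
mulAll-cong[] []            p = p
mulAll-cong[] ((e , a) ∷ L) p = mulBy-cong[] e a (mulAll-cong[] L p)

mulBy-high : ∀ e a {f} d → IsPowerSeries f → d < + a → mulBy e a f ≈[ d ] f
mulBy-high e a {f} d p d<a x x≤d = begin
  f x - e * f (x - + a) ≡⟨ cong (λ t → f x - e * t) (vanish p (shift-neg x≤d d<a)) ⟩
  f x - e * + 0         ≡⟨ cong (λ t → f x - t) (ℤP.*-zeroʳ e) ⟩
  f x - + 0             ≡⟨ ℤP.+-identityʳ (f x) ⟩
  f x                   ∎

-- For a ≥ 1, multiplication by 1 - qᵃ is injective on power series, degree by degree:
-- the coefficient of qʸ is recovered from those of the product and of lower degree.
mulBy-cancel : ∀ a {f g} d → 1 ℕ.≤ a → IsPowerSeries f → IsPowerSeries g →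
               mulBy (+ 1) a f ≈[ d ] mulBy (+ 1) a g → f ≈[ d ] g
mulBy-cancel a {f} {g} d a≥1 pf pg eq x x≤d = below (suc ℤ.∣ x ∣) x (below-suc∣∣ x) x≤d
  where
  below-suc∣∣ : ∀ y → y < + suc ℤ.∣ y ∣
  below-suc∣∣ (+ n)    = ℤ.+<+ (ℕP.n<1+n n)
  below-suc∣∣ -[1+ n ] = ℤ.-<+
  step-down : ∀ {y k} → y < + suc k → y - + a < + k
  step-down {y} {k} y<k+1 = ℤP.≤-<-trans (ℤP.+-monoʳ-≤ y (ℤP.neg-mono-≤ (ℤ.+≤+ a≥1)))
    (ℤP.+-monoˡ-< (- + 1) y<k+1)
  recover : ∀ (u v : ℤ) → u ≡ (u - + 1 * v) + v
  recover = solve-∀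
  below : ∀ k y → y < + k → y ≤ d → f y ≡ g y
  below zero    y y<0   _   = trans (vanish pf y<0) (sym (vanish pg y<0))
  below (suc k) y y<k+1 y≤d = begin
    f y                             ≡⟨ recover (f y) (f (y - + a)) ⟩
    mulBy (+ 1) a f y + f (y - + a) ≡⟨ cong₂ _+_ (eq y y≤d) (below k (y - + a) (step-down y<k+1) (shift-le a y≤d)) ⟩
    mulBy (+ 1) a g y + g (y - + a) ≡⟨ sym (recover (g y) (g (y - + a))) ⟩
    g y                             ∎

data Cancellable : List Factor → Set where
  []  : Cancellable []
  _∷_ : ∀ {a L} → 1 ℕ.≤ a → Cancellable L → Cancellable ((+ 1 , a) ∷ L)

mulAll-cancel : ∀ {L} → Cancellable L → ∀ {f g} d → IsPowerSeries f → IsPowerSeries g →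
                mulAll L f ≈[ d ] mulAll L g → f ≈[ d ] g
mulAll-cancel []                   d pf pg eq = eq
mulAll-cancel (_∷_ {a} {L} a≥1 cL) d pf pg eq =
  mulAll-cancel cL d pf pg (mulBy-cancel a d a≥1 (mulAll-power L pf) (mulAll-power L pg) eq)

-- Deducing an equation L ≡ R from a ring identity expressing L - R through differences
-- h - h' that are known to vanish.  This lets the ring solver prove identities under
-- equational hypotheses.
from-difference : ∀ {L R h h' : ℤ} (c : ℤ) → L - R ≡ c * (h - h') → h ≡ h' → L ≡ R
from-difference {L} {R} {h} c eq refl =
  ℤP.i-j≡0⇒i≡j L R (trans eq (trans (cong (c *_) (ℤP.+-inverseʳ h)) (ℤP.*-zeroʳ c)))

from-difference₂ : ∀ {L R h h' g g' : ℤ} (c d : ℤ) → L - R ≡ c * (h - h') + d * (g - g') →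
                   h ≡ h' → g ≡ g' → L ≡ R
from-difference₂ {L} {R} {h} {_} {g} c d eq refl refl =
  ℤP.i-j≡0⇒i≡j L R (trans eq (trans (cong₂ (λ u v → c * u + d * v) (ℤP.+-inverseʳ h) (ℤP.+-inverseʳ g))
                                    (cong₂ _+_ (ℤP.*-zeroʳ c) (ℤP.*-zeroʳ d))))

rangeSum : (ℤ → ℤ) → ℤ → ℕ → ℤ
rangeSum φ a zero    = + 0
rangeSum φ a (suc L) = φ a + rangeSum φ (a + + 1) L

rangeSum-cong : ∀ (φ ψ : ℤ → ℤ) a L → (∀ i → i ℕ.< L → φ (a + + i) ≡ ψ (a + + i)) →
                rangeSum φ a L ≡ rangeSum ψ a L
rangeSum-cong φ ψ a zero    p = refl
rangeSum-cong φ ψ a (suc L) p =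
  cong₂ _+_ (subst (λ t → φ t ≡ ψ t) (ℤP.+-identityʳ a) (p 0 (ℕ.s≤s ℕ.z≤n)))
            (rangeSum-cong φ ψ (a + + 1) L λ i i<L →
               subst (λ t → φ t ≡ ψ t) (sym (ℤP.+-assoc a (+ 1) (+ i))) (p (suc i) (ℕ.s≤s i<L)))

rangeSum-ext : ∀ (φ ψ : ℤ → ℤ) a L → (∀ j → φ j ≡ ψ j) → rangeSum φ a L ≡ rangeSum ψ a L
rangeSum-ext φ ψ a L p = rangeSum-cong φ ψ a L (λ i _ → p (a + + i))

rangeSum-snoc : ∀ (φ : ℤ → ℤ) a L → rangeSum φ a (suc L) ≡ rangeSum φ a L + φ (a + + L)
rangeSum-snoc φ a zero    = trans (ℤP.+-comm (φ a) (+ 0)) (cong (λ t → + 0 + φ t) (sym (ℤP.+-identityʳ a)))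
rangeSum-snoc φ a (suc L) = begin
  φ a + rangeSum φ (a + + 1) (suc L)                      ≡⟨ cong (λ t → φ a + t) (rangeSum-snoc φ (a + + 1) L) ⟩
  φ a + (rangeSum φ (a + + 1) L + φ ((a + + 1) + + L))    ≡⟨ sym (ℤP.+-assoc (φ a) _ _) ⟩
  (φ a + rangeSum φ (a + + 1) L) + φ ((a + + 1) + + L)    ≡⟨ cong (λ t → (φ a + rangeSum φ (a + + 1) L) + φ t) (ℤP.+-assoc a (+ 1) (+ L)) ⟩
  (φ a + rangeSum φ (a + + 1) L) + φ (a + + suc L)        ∎

rangeSum-shift : ∀ (φ : ℤ → ℤ) k a L → rangeSum (λ j → φ (j + k)) a L ≡ rangeSum φ (a + k) L
rangeSum-shift φ k a zero    = refl
rangeSum-shift φ k a (suc L) =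
  cong (λ t → φ (a + k) + t) (trans (rangeSum-shift φ k (a + + 1) L) (cong (λ t → rangeSum φ t L) (swap a k)))
  where
  swap : ∀ (a k : ℤ) → a + + 1 + k ≡ a + k + + 1
  swap = solve-∀

rangeSum-+ : ∀ (φ ψ : ℤ → ℤ) a L → rangeSum (λ j → φ j + ψ j) a L ≡ rangeSum φ a L + rangeSum ψ a L
rangeSum-+ φ ψ a zero    = refl
rangeSum-+ φ ψ a (suc L) =
  trans (cong (λ t → (φ a + ψ a) + t) (rangeSum-+ φ ψ (a + + 1) L))
        (interchange (φ a) (ψ a) (rangeSum φ (a + + 1) L) (rangeSum ψ (a + + 1) L))
  where
  interchange : ∀ (u v w z : ℤ) → (u + v) + (w + z) ≡ (u + w) + (v + z)
  interchange = solve-∀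

rangeSum-* : ∀ (c : ℤ) (φ : ℤ → ℤ) a L → rangeSum (λ j → c * φ j) a L ≡ c * rangeSum φ a L
rangeSum-* c φ a zero    = sym (ℤP.*-zeroʳ c)
rangeSum-* c φ a (suc L) =
  trans (cong (λ t → c * φ a + t) (rangeSum-* c φ (a + + 1) L)) (sym (ℤP.*-distribˡ-+ c (φ a) _))

rangeSum-- : ∀ (φ : ℤ → ℤ) a L → rangeSum (λ j → - φ j) a L ≡ - rangeSum φ a L
rangeSum-- φ a zero    = refl
rangeSum-- φ a (suc L) = trans (cong (λ t → - φ a + t) (rangeSum-- φ (a + + 1) L)) (sym (ℤP.neg-distrib-+ (φ a) _))

rangeSum-linear : ∀ (e : ℤ) (φ ψ : ℤ → ℤ) a L →
                  rangeSum (λ j → φ j - e * ψ j) a L ≡ rangeSum φ a L - e * rangeSum ψ a L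
rangeSum-linear e φ ψ a L = begin
  rangeSum (λ j → φ j - e * ψ j) a L             ≡⟨ rangeSum-+ φ (λ j → - (e * ψ j)) a L ⟩
  rangeSum φ a L + rangeSum (λ j → - (e * ψ j)) a L ≡⟨ cong (λ t → rangeSum φ a L + t) (rangeSum-- (λ j → e * ψ j) a L) ⟩
  rangeSum φ a L + - rangeSum (λ j → e * ψ j) a L ≡⟨ cong (λ t → rangeSum φ a L + - t) (rangeSum-* e ψ a L) ⟩
  rangeSum φ a L - e * rangeSum ψ a L            ∎

rangeSum-zero : ∀ (φ : ℤ → ℤ) a L → (∀ i → i ℕ.< L → φ (a + + i) ≡ + 0) → rangeSum φ a L ≡ + 0
rangeSum-zero φ a L p = trans (rangeSum-cong φ (λ _ → + 0) a L p) (zeros a L)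
  where
  zeros : ∀ a L → rangeSum (λ _ → + 0) a L ≡ + 0
  zeros a zero    = refl
  zeros a (suc L) = trans (ℤP.+-identityˡ _) (zeros (a + + 1) L)

rangeSum-single : ∀ (φ : ℤ → ℤ) a L i₀ → i₀ ℕ.< L → (∀ i → i ℕ.< L → i ≢ i₀ → φ (a + + i) ≡ + 0) →
                  rangeSum φ a L ≡ φ (a + + i₀)
rangeSum-single φ a (suc L) zero _ p = begin
  φ a + rangeSum φ (a + + 1) L ≡⟨ cong (λ t → φ a + t) (rangeSum-zero φ (a + + 1) L λ i i<L →
                                    subst (λ t → φ t ≡ + 0) (sym (ℤP.+-assoc a (+ 1) (+ i))) (p (suc i) (ℕ.s≤s i<L) (λ ()))) ⟩
  φ a + + 0                    ≡⟨ ℤP.+-identityʳ (φ a) ⟩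
  φ a                          ≡⟨ cong φ (sym (ℤP.+-identityʳ a)) ⟩
  φ (a + + 0)                  ∎
rangeSum-single φ a (suc L) (suc i₀) (ℕ.s≤s i₀<L) p = begin
  φ a + rangeSum φ (a + + 1) L ≡⟨ cong₂ _+_ (subst (λ t → φ t ≡ + 0) (ℤP.+-identityʳ a) (p 0 (ℕ.s≤s ℕ.z≤n) (λ ())))
                                    (rangeSum-single φ (a + + 1) L i₀ i₀<L λ i i<L i≢i₀ →
                                       subst (λ t → φ t ≡ + 0) (sym (ℤP.+-assoc a (+ 1) (+ i)))
                                             (p (suc i) (ℕ.s≤s i<L) (λ e → i≢i₀ (ℕP.suc-injective e)))) ⟩
  + 0 + φ ((a + + 1) + + i₀)   ≡⟨ ℤP.+-identityˡ _ ⟩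
  φ ((a + + 1) + + i₀)         ≡⟨ cong φ (ℤP.+-assoc a (+ 1) (+ i₀)) ⟩
  φ (a + + suc i₀)             ∎

rangeSum-slide : ∀ (φ : ℤ → ℤ) a L → φ (a - + 1) ≡ + 0 → φ (a + + L) ≡ + 0 →
                 rangeSum φ (a - + 1) (suc L) ≡ rangeSum φ a (suc L)
rangeSum-slide φ a L first last = begin
  φ (a - + 1) + rangeSum φ (a - + 1 + + 1) L ≡⟨ cong₂ _+_ first (cong (λ t → rangeSum φ t L) (back a)) ⟩
  + 0 + rangeSum φ a L                       ≡⟨ ℤP.+-identityˡ _ ⟩
  rangeSum φ a L                             ≡⟨ sym (ℤP.+-identityʳ _) ⟩
  rangeSum φ a L + + 0                       ≡⟨ cong (λ t → rangeSum φ a L + t) (sym last) ⟩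
  rangeSum φ a L + φ (a + + L)               ≡⟨ sym (rangeSum-snoc φ a L) ⟩
  rangeSum φ a (suc L)                       ∎
  where
  back : ∀ (a : ℤ) → a - + 1 + + 1 ≡ a
  back = solve-∀

seriesSum : (ℤ → Series) → ℤ → ℕ → Series
seriesSum g a L x = rangeSum (λ j → g j x) a L

mulAll-seriesSum : ∀ M g a L → mulAll M (seriesSum g a L) ≈ seriesSum (λ j → mulAll M (g j)) a L
mulAll-seriesSum []            g a L = ≈-refl
mulAll-seriesSum ((e , b) ∷ M) g a L =
  ≈-trans (mulBy-cong e b (mulAll-seriesSum M g a L))
          (λ x → sym (rangeSum-linear e (λ j → mulAll M (g j) x) (λ j → mulAll M (g j) (x - + b)) a L))

-- Gaussian binomial coefficients in the base Q = qˢ, as series in q: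
--   gauss n k = [n k]_Q, defined by the Pascal rule [n+1 k] = [n k-1] + Qᵏ [n k],
-- and vanishing for k < 0 and k > n.
module Gaussian (s : ℕ) where

  Q : ℤ → ℤ
  Q t = + s * t

  Q-zero : ∀ x → x - Q (+ 0) ≡ x
  Q-zero x = trans (cong (λ t → x - t) (ℤP.*-zeroʳ (+ s))) (ℤP.+-identityʳ x)

  gauss : ℕ → ℤ → Series
  gauss zero    (+ zero)  = one
  gauss zero    (+ suc _) = λ _ → + 0
  gauss zero    -[1+ _ ]  = λ _ → + 0
  gauss (suc n) k x       = gauss n (k - + 1) x + gauss n k (x - Q k)

  gauss-below : ∀ n k x → k < + 0 → gauss n k x ≡ + 0
  gauss-below zero    (+ n)    x (ℤ.+<+ ())
  gauss-below zero    -[1+ m ] x _ = refl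
  gauss-below (suc n) k        x k<0 =
    cong₂ _+_ (gauss-below n (k - + 1) x (ℤP.≤-<-trans (ℤP.i-j≤i k (+ 1)) k<0)) (gauss-below n k _ k<0)

  gauss-above : ∀ n k x → + n < k → gauss n k x ≡ + 0
  gauss-above zero    (+ zero)  x (ℤ.+<+ ())
  gauss-above zero    (+ suc m) x _ = refl
  gauss-above (suc n) k         x n<k =
    cong₂ _+_ (gauss-above n (k - + 1) x (ℤP.+-monoˡ-< (- + 1) n<k))
              (gauss-above n k _ (ℤP.<-trans (ℤ.+<+ (ℕP.n<1+n n)) n<k))

  gauss-power : ∀ n k → IsPowerSeries (gauss n k)
  gauss-power zero    (+ zero)  = one-power
  gauss-power zero    (+ suc _) = powerSeries λ _ → refl
  gauss-power zero    -[1+ _ ]  = powerSeries λ _ → refl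
  gauss-power (suc n) k         =
    powerSeries λ m → cong₂ _+_ (negative-zero (gauss-power n (k - + 1)) m) (shifted k m)
    where
    shifted : ∀ k m → gauss n k (-[1+ m ] - Q k) ≡ + 0
    shifted (+ k')    m = vanish (gauss-power n (+ k'))
      (subst (λ t → -[1+ m ] - t < + 0) (ℤP.pos-* s k') (shift-neg {a = + (s ℕ.* k')} ℤP.≤-refl ℤ.-<+))
    shifted -[1+ k' ] m = gauss-below n _ _ ℤ.-<+

  gauss-zero : ∀ n x → gauss n (+ 0) x ≡ one x
  gauss-zero zero    x = refl
  gauss-zero (suc n) x =
    trans (cong₂ _+_ (gauss-below n (+ 0 - + 1) x ℤ.-<+) (trans (gauss-zero n _) (cong one (Q-zero x))))
          (ℤP.+-identityˡ _)

  gauss-ratio : ∀ n k x → gauss n k x - gauss n k (x - Q k)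
                        ≡ gauss n (k - + 1) x - gauss n (k - + 1) (x - Q (+ n - k + + 1))
  gauss-ratio zero (+ zero) x = begin
    one x - one (x - Q (+ 0)) ≡⟨ cong (λ t → one x - one t) (Q-zero x) ⟩
    one x - one x             ≡⟨ ℤP.+-inverseʳ (one x) ⟩
    + 0                       ∎
  gauss-ratio zero (+ suc zero)    x = sym (trans (cong (λ t → one x - one t) (Q-zero x)) (ℤP.+-inverseʳ (one x)))
  gauss-ratio zero (+ suc (suc m)) x = refl
  gauss-ratio zero -[1+ m ]        x = refl
  gauss-ratio (suc n) k x =
    trans (from-difference₂ (+ 1) (+ 1) (combine A G I H D C E W) ratio-k ratio-k-1)
          (cong (λ t → (D + C) - (E + gauss n (k - + 1) t)) (sym (exponent₃ x (+ s) k (+ n))))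
    where
    A G I H C D E W : ℤ
    A = gauss n (k - + 1) x
    G = gauss n k (x - Q k)
    I = gauss n (k - + 1) (x - Q k)
    H = gauss n k ((x - Q k) - Q k)
    C = gauss n (k - + 1) (x - Q (k - + 1))
    D = gauss n (k - + 1 - + 1) x
    E = gauss n (k - + 1 - + 1) (x - Q (+ 1 + + n - k + + 1))
    W = gauss n (k - + 1) (x - Q (+ 1 + + n))
    exponent₁ : ∀ (x s k n : ℤ) → (x - s * k) - s * (n - k + + 1) ≡ x - s * (+ 1 + n)
    exponent₁ = solve-∀
    exponent₂ : ∀ (x s k n : ℤ) → x - s * (n - (k - + 1) + + 1) ≡ x - s * (+ 1 + n - k + + 1)
    exponent₂ = solve-∀
    exponent₃ : ∀ (x s k n : ℤ) → (x - s * (+ 1 + n - k + + 1)) - s * (k - + 1) ≡ x - s * (+ 1 + n)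
    exponent₃ = solve-∀
    ratio-k : G - H ≡ I - W
    ratio-k = trans (gauss-ratio n k (x - Q k)) (cong (λ t → I - gauss n (k - + 1) t) (exponent₁ x (+ s) k (+ n)))
    ratio-k-1 : A - C ≡ D - E
    ratio-k-1 = trans (gauss-ratio n (k - + 1) x) (cong (λ t → D - gauss n (k - + 1 - + 1) t) (exponent₂ x (+ s) k (+ n)))
    combine : ∀ (A G I H D C E W : ℤ) →
              ((A + G) - (I + H)) - ((D + C) - (E + W)) ≡ + 1 * ((G - H) - (I - W)) + + 1 * ((A - C) - (D - E))
    combine = solve-∀

  -- Applying the Pascal rule twice, in its two mirrored forms:
  --   [n+2 k+1] = Qⁿ⁻ᵏ⁺¹ [n k-1] + (1 + Qⁿ⁺¹) [n k] + Qᵏ⁺¹ [n k+1].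
  gauss-pascal₂ : ∀ n k x → gauss (suc (suc n)) (k + + 1) x
                          ≡ gauss n (k - + 1) (x - Q (+ n - k + + 1)) + gauss n k x
                            + gauss n k (x - Q (+ 1 + + n)) + gauss n (k + + 1) (x - Q (k + + 1))
  gauss-pascal₂ n k x =
    trans (unfold (k + + 1 - + 1 - + 1) (k + + 1 - + 1) (down₂ k) (down₁ k))
          (from-difference₂ (- + 1) (- + 1) (combine P₁ P₂ P₃ P₄ T₁ T₂ T₃ T₄) ratio-k ratio-k+1)
    where
    x' P₁ P₂ P₃ P₄ T₁ T₂ T₃ T₄ : ℤ
    x' = x - Q (k + + 1)
    P₁ = gauss n (k - + 1) x
    P₂ = gauss n k (x - Q k)
    P₃ = gauss n k x'
    P₄ = gauss n (k + + 1) (x' - Q (k + + 1))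
    T₁ = gauss n (k - + 1) (x - Q (+ n - k + + 1))
    T₂ = gauss n k x
    T₃ = gauss n k (x - Q (+ 1 + + n))
    T₄ = gauss n (k + + 1) x'
    down₂ : ∀ (k : ℤ) → k + + 1 - + 1 - + 1 ≡ k - + 1
    down₂ = solve-∀
    down₁ : ∀ (k : ℤ) → k + + 1 - + 1 ≡ k
    down₁ = solve-∀
    unfold : ∀ t u → t ≡ k - + 1 → u ≡ k → (gauss n t x + gauss n u (x - Q u)) + (gauss n u x' + P₄) ≡ (P₁ + P₂) + (P₃ + P₄)
    unfold _ _ refl refl = refl
    ratio-k : T₂ - P₂ ≡ P₁ - T₁
    ratio-k = gauss-ratio n k x
    exponent : ∀ (x s k n : ℤ) → (x - s * (k + + 1)) - s * (n - (k + + 1) + + 1) ≡ x - s * (+ 1 + n)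
    exponent = solve-∀
    align : ∀ u z → u ≡ k → z ≡ x - Q (+ 1 + + n) → gauss n u x' - gauss n u z ≡ P₃ - T₃
    align _ _ refl refl = refl
    ratio-k+1 : T₄ - P₄ ≡ P₃ - T₃
    ratio-k+1 = trans (gauss-ratio n (k + + 1) x') (align _ _ (down₁ k) (exponent x (+ s) k (+ n)))
    combine : ∀ (P₁ P₂ P₃ P₄ T₁ T₂ T₃ T₄ : ℤ) → ((P₁ + P₂) + (P₃ + P₄)) - (T₁ + T₂ + T₃ + T₄)
              ≡ (- + 1) * ((T₂ - P₂) - (P₁ - T₁)) + (- + 1) * ((T₄ - P₄) - (P₃ - T₃))
    combine = solve-∀

  gauss-absorb : ∀ n k → mulBy (+ 1) (s ℕ.* suc k) (gauss (suc n) (+ suc k))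
                       ≈ mulBy (+ 1) (s ℕ.* suc n) (gauss n (+ k))
  gauss-absorb n k x =
    trans (cong (λ u → gauss (suc n) (+ suc k) x - + 1 * gauss (suc n) (+ suc k) (x - u)) (ℤP.pos-* s (suc k)))
    (trans (from-difference (+ 1) (combine P₁ P₂ P₃ P₄ R) ratio)
           (cong (λ u → gauss n (+ k) x - + 1 * gauss n (+ k) (x - u)) (sym (ℤP.pos-* s (suc n)))))
    where
    x' P₁ P₂ P₃ P₄ R : ℤ
    x' = x - Q (+ suc k)
    P₁ = gauss n (+ k) x
    P₂ = gauss n (+ suc k) x'
    P₃ = gauss n (+ k) x'
    P₄ = gauss n (+ suc k) (x' - Q (+ suc k))
    R  = gauss n (+ k) (x - Q (+ 1 + + n))
    exponent : ∀ (x s k n : ℤ) → (x - s * (+ 1 + k)) - s * (n - (+ 1 + k) + + 1) ≡ x - s * (+ 1 + n)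
    exponent = solve-∀
    ratio : P₂ - P₄ ≡ P₃ - R
    ratio = trans (gauss-ratio n (+ suc k) x') (cong (λ t → P₃ - gauss n (+ k) t) (exponent x (+ s) (+ k) (+ n)))
    combine : ∀ (P₁ P₂ P₃ P₄ R : ℤ) → ((P₁ + P₂) - + 1 * (P₃ + P₄)) - (P₁ - + 1 * R) ≡ + 1 * ((P₂ - P₄) - (P₃ - R))
    combine = solve-∀

  qPoch : ℕ → List Factor
  qPoch zero    = []
  qPoch (suc k) = (+ 1 , s ℕ.* suc k) ∷ qPoch k

  topFactors : ℕ → ℕ → List Factor
  topFactors n       zero    = []
  topFactors zero    (suc k) = []
  topFactors (suc n) (suc k) = (+ 1 , s ℕ.* suc n) ∷ topFactors n k

  gauss-qfactorial : ∀ n k → k ℕ.≤ n → mulAll (qPoch k) (gauss n (+ k)) ≈ mulAll (topFactors n k) one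
  gauss-qfactorial n       zero    _           = gauss-zero n
  gauss-qfactorial (suc n) (suc k) (ℕ.s≤s k≤n) =
    ≈-trans (mulBy-mulAll (+ 1) (s ℕ.* suc k) (qPoch k) (gauss (suc n) (+ suc k)))
    (≈-trans (mulAll-cong (qPoch k) (gauss-absorb n k))
    (≈-trans (≈-sym (mulBy-mulAll (+ 1) (s ℕ.* suc n) (qPoch k) (gauss n (+ k))))
             (mulBy-cong (+ 1) (s ℕ.* suc n) (gauss-qfactorial n k k≤n))))

  topFactors-high : ∀ n k d {f} → IsPowerSeries f → d < + (s ℕ.* (suc n ℕ.∸ k)) →
                    mulAll (topFactors n k) f ≈[ d ] f
  topFactors-high n       zero    d pf d< = λ _ _ → refl
  topFactors-high zero    (suc k) d pf d< = λ _ _ → refl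
  topFactors-high (suc n) (suc k) d pf d< =
    ≈[]-trans (mulBy-high (+ 1) (s ℕ.* suc n) d (mulAll-power (topFactors n k) pf)
                          (ℤP.<-≤-trans d< (ℤ.+≤+ (ℕP.*-monoʳ-≤ s (ℕP.m∸n≤m (suc n) k)))))
              (topFactors-high n k d pf d<)

  qPoch-high : ∀ m k d {g} → IsPowerSeries g → d < + (s ℕ.* suc k) →
               mulAll (qPoch (m ℕ.+ k)) g ≈[ d ] mulAll (qPoch k) g
  qPoch-high zero    k d pg d< = λ _ _ → refl
  qPoch-high (suc m) k d pg d< =
    ≈[]-trans (mulBy-high (+ 1) (s ℕ.* suc (m ℕ.+ k)) d (mulAll-power (qPoch (m ℕ.+ k)) pg)
                          (ℤP.<-≤-trans d< (ℤ.+≤+ (ℕP.*-monoʳ-≤ s (ℕ.s≤s (ℕP.m≤n+m k m))))))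
              (qPoch-high m k d pg d<)

  -- Up to degree d < s(k+1), s(l+1), the series (Q ; Q)_K [k+l k] equals 1 for K ≥ k:
  -- every factor of both products in gauss-qfactorial has degree beyond d.
  gauss-limit : ∀ n K k l d → k ℕ.+ l ≡ n → k ℕ.≤ K → d < + (s ℕ.* suc k) → d < + (s ℕ.* suc l) →
                mulAll (qPoch K) (gauss n (+ k)) ≈[ d ] one
  gauss-limit _ K k l d refl k≤K d<₁ d<₂ =
    subst (λ M → mulAll (qPoch M) (gauss (k ℕ.+ l) (+ k)) ≈[ d ] one) (ℕP.m∸n+n≡m k≤K)
      (≈[]-trans (qPoch-high (K ℕ.∸ k) k d (gauss-power (k ℕ.+ l) (+ k)) d<₁)
      (≈[]-trans (≈⇒≈[] d (gauss-qfactorial (k ℕ.+ l) k (ℕP.m≤m+n k l)))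
                 (topFactors-high (k ℕ.+ l) k d one-power (subst (λ t → d < + (s ℕ.* t)) (sym top) d<₂))))
    where
    top : suc (k ℕ.+ l) ℕ.∸ k ≡ suc l
    top = trans (cong (ℕ._∸ k) (sym (ℕP.+-suc k l))) (ℕP.m+n∸m≡n k (suc l))

-- Structural doubling, so that ranges of length 2R + 1 unfold by pattern matching.
double : ℕ → ℕ
double zero    = zero
double (suc n) = suc (suc (double n))

double-+ : ∀ n → double n ≡ n ℕ.+ n
double-+ zero    = refl
double-+ (suc n) = cong suc (trans (cong suc (double-+ n)) (sym (ℕP.+-suc n n)))

double-+ℤ : ∀ n → + double n ≡ + n + + n
double-+ℤ n = trans (cong +_ (double-+ n)) (ℤP.pos-+ n n)

n≤double : ∀ n → n ℕ.≤ double n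
n≤double n = subst (n ℕ.≤_) (sym (double-+ n)) (ℕP.m≤m+n n n)

symSum : (ℤ → ℤ) → ℕ → ℤ
symSum φ R = rangeSum φ (- + R) (suc (double R))

symSum-down : ∀ (φ : ℤ → ℤ) R → φ (- + R - + 1) ≡ + 0 → φ (- + R + + double R) ≡ + 0 →
              symSum (λ j → φ (j - + 1)) R ≡ symSum φ R
symSum-down φ R first last =
  trans (rangeSum-shift φ -[1+ 0 ] (- + R) (suc (double R))) (rangeSum-slide φ (- + R) (double R) first last)

symSum-up : ∀ (φ : ℤ → ℤ) R → φ (- + R) ≡ + 0 → φ (- + R + + 1 + + double R) ≡ + 0 →
            symSum (λ j → φ (j + + 1)) R ≡ symSum φ R
symSum-up φ R first last =
  trans (rangeSum-shift φ (+ 1) (- + R) (suc (double R)))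
  (trans (sym (rangeSum-slide φ (- + R + + 1) (double R) (trans (cong φ (back (- + R))) first) last))
         (cong (λ a → rangeSum φ a (suc (double R))) (back (- + R))))
  where
  back : ∀ (a : ℤ) → a + + 1 - + 1 ≡ a
  back = solve-∀

pairSum : (ℤ → ℤ) → ℕ → ℤ
pairSum φ zero    = + 0
pairSum φ (suc R) = pairSum φ R + (φ (+ suc R) + φ (- + suc R))

symSum-pairs : ∀ (φ : ℤ → ℤ) R → symSum φ R ≡ φ (+ 0) + pairSum φ R
symSum-pairs φ zero    = refl
symSum-pairs φ (suc R) = begin
  φ (- + suc R) + rangeSum φ (- + suc R + + 1) (suc (suc (double R)))
    ≡⟨ cong (λ a → φ (- + suc R) + rangeSum φ a (suc (suc (double R)))) (left (+ R)) ⟩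
  φ (- + suc R) + rangeSum φ (- + R) (suc (suc (double R)))
    ≡⟨ cong (λ t → φ (- + suc R) + t) (rangeSum-snoc φ (- + R) (suc (double R))) ⟩
  φ (- + suc R) + (symSum φ R + φ (- + R + + suc (double R)))
    ≡⟨ cong₂ (λ a b → φ (- + suc R) + (a + φ b)) (symSum-pairs φ R) (right (+ R) (+ double R) (double-+ℤ R)) ⟩
  φ (- + suc R) + ((φ (+ 0) + pairSum φ R) + φ (+ suc R))
    ≡⟨ regroup (φ (- + suc R)) (φ (+ 0)) (pairSum φ R) (φ (+ suc R)) ⟩
  φ (+ 0) + (pairSum φ R + (φ (+ suc R) + φ (- + suc R))) ∎
  where
  left : ∀ (R : ℤ) → - (+ 1 + R) + + 1 ≡ - R
  left = solve-∀
  right-solved : ∀ (R : ℤ) → - R + (+ 1 + (R + R)) ≡ + 1 + R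
  right-solved = solve-∀
  right : ∀ (R D : ℤ) → D ≡ R + R → - R + (+ 1 + D) ≡ + 1 + R
  right R D refl = right-solved R
  regroup : ∀ (a b c d : ℤ) → a + ((b + c) + d) ≡ b + (c + (d + a))
  regroup = solve-∀

-- Fix h and c, c' ≥ 1 with c + c' = 2h, put s = c + c',
-- Q = qˢ, and let ε = ±1, u = -ε.  Then for N < R
--   ∏_{i<N} (1 - ε q^{c+si}) (1 - ε q^{c'+si}) = Σ_{|j|≤R} u^|j| q^{e(j)} [2N N+j]_Q
-- with e(j) = h j(j-1) + c j.  The proof is by induction on N: multiplying the right side
-- by the two new factors and using the double Pascal rule reproduces it termwise.
module TripleProduct (h c₀ c₀' : ℕ) (balanced : suc c₀ ℕ.+ suc c₀' ≡ h ℕ.+ h)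
                     (ε : ℤ) (ε²≡1 : ε * ε ≡ + 1) where

  c c' s : ℕ
  c  = suc c₀
  c' = suc c₀'
  s  = c ℕ.+ c'

  open Gaussian s public

  u : ℤ
  u = - ε

  u²≡1 : u * u ≡ + 1
  u²≡1 = trans (neg-square ε) ε²≡1
    where
    neg-square : ∀ (x : ℤ) → - x * - x ≡ x * x
    neg-square = solve-∀

  -- Since u² = 1, u^|j| = uʲ for all j ∈ ℤ; these are its recurrences.
  upow : ℤ → ℤ
  upow j = u ^ ℤ.∣ j ∣

  upow-pred : ∀ j → upow j ≡ u * upow (j - + 1)
  upow-pred (+ zero)  = sym (trans (cong (u *_) (ℤP.*-identityʳ u)) u²≡1)
  upow-pred (+ suc n) = refl
  upow-pred -[1+ n ]  = begin
    u ^ suc n           ≡⟨ sym (ℤP.*-identityˡ _) ⟩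
    + 1 * u ^ suc n     ≡⟨ cong (_* u ^ suc n) (sym u²≡1) ⟩
    (u * u) * u ^ suc n ≡⟨ ℤP.*-assoc u u _ ⟩
    u * (u * u ^ suc n) ≡⟨ cong (λ t → u * (u * u ^ suc t)) (sym (ℕP.+-identityʳ n)) ⟩
    u * upow (-[1+ n ] - + 1) ∎

  upow-suc : ∀ j → upow j ≡ u * upow (j + + 1)
  upow-suc j = begin
    upow j                         ≡⟨ cong upow (sym (back j)) ⟩
    upow (j + + 1 - + 1)           ≡⟨ sym (ℤP.*-identityˡ _) ⟩
    + 1 * upow (j + + 1 - + 1)     ≡⟨ cong (_* upow (j + + 1 - + 1)) (sym u²≡1) ⟩
    (u * u) * upow (j + + 1 - + 1) ≡⟨ ℤP.*-assoc u u _ ⟩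
    u * (u * upow (j + + 1 - + 1)) ≡⟨ cong (u *_) (sym (upow-pred (j + + 1))) ⟩
    u * upow (j + + 1)             ∎
    where
    back : ∀ (j : ℤ) → j + + 1 - + 1 ≡ j
    back = solve-∀

  expo : ℤ → ℤ
  expo j = + h * (j * (j - + 1)) + + c * j

  expo-zero : expo (+ 0) ≡ + 0
  expo-zero = at-zero (+ h) (+ c)
    where
    at-zero : ∀ (H C : ℤ) → H * (+ 0 * (+ 0 - + 1)) + C * + 0 ≡ + 0
    at-zero = solve-∀

  tripleFactors : ℕ → List Factor
  tripleFactors zero    = []
  tripleFactors (suc N) = (ε , c ℕ.+ s ℕ.* N) ∷ (ε , c' ℕ.+ s ℕ.* N) ∷ tripleFactors N

  summand : ℕ → ℤ → Series
  summand N j x = upow j * gauss (double N) (+ N + j) (x - expo j)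

  theta : ℕ → ℕ → Series
  theta N R x = symSum (λ j → summand N j x) R

  summand-below : ∀ N j x → j < - + N → summand N j x ≡ + 0
  summand-below N j x j<-N = trans (cong (upow j *_) (gauss-below (double N) (+ N + j) _ N+j<0)) (ℤP.*-zeroʳ (upow j))
    where
    N+j<0 : + N + j < + 0
    N+j<0 = subst (+ N + j <_) (ℤP.+-inverseʳ (+ N)) (ℤP.+-monoʳ-< (+ N) j<-N)

  summand-above : ∀ N j x → + N < j → summand N j x ≡ + 0
  summand-above N j x N<j = trans (cong (upow j *_) (gauss-above (double N) (+ N + j) _ 2N<N+j)) (ℤP.*-zeroʳ (upow j))
    where
    2N<N+j : + double N < + N + j
    2N<N+j = subst (_< + N + j) (sym (double-+ℤ N)) (ℤP.+-monoʳ-< (+ N) N<j)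

  s≡c+c' : + s ≡ + c + + c'
  s≡c+c' = ℤP.pos-+ c c'

  c'≡2h-c : + c' ≡ (+ h + + h) - + c
  c'≡2h-c = begin
    + c'               ≡⟨ sym (cancel (+ c) (+ c')) ⟩
    (+ c + + c') - + c ≡⟨ cong (_- + c) (sym (ℤP.pos-+ c c')) ⟩
    + (c ℕ.+ c') - + c ≡⟨ cong (λ t → + t - + c) balanced ⟩
    + (h ℕ.+ h) - + c  ≡⟨ cong (_- + c) (ℤP.pos-+ h h) ⟩
    (+ h + + h) - + c  ∎
    where
    cancel : ∀ (a b : ℤ) → (a + b) - a ≡ b
    cancel = solve-∀

  factorExponent : ∀ a N → + (a ℕ.+ s ℕ.* N) ≡ + a + + s * + N
  factorExponent a N = trans (ℤP.pos-+ a (s ℕ.* N)) (cong (λ t → + a + t) (ℤP.pos-* s N))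

  shift-left : ∀ x N j → (x - + (c ℕ.+ s ℕ.* N)) - expo (j - + 1) ≡ (x - expo j) - Q (+ double N - (+ N + j) + + 1)
  shift-left x N j = instantiate x (+ N) j (+ h) (+ c) (+ c') (+ s) (+ double N) (+ (c ℕ.+ s ℕ.* N))
                                 c'≡2h-c s≡c+c' (double-+ℤ N) (factorExponent c N)
    where
    solved : ∀ (x N j H C : ℤ) → (x - (C + (C + ((H + H) - C)) * N)) - (H * ((j - + 1) * (j - + 1 - + 1)) + C * (j - + 1))
                               ≡ (x - (H * (j * (j - + 1)) + C * j)) - (C + ((H + H) - C)) * ((N + N) - (N + j) + + 1)
    solved = solve-∀
    instantiate : ∀ (x N j H C C' S D A : ℤ) → C' ≡ (H + H) - C → S ≡ C + C' → D ≡ N + N → A ≡ C + S * N →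
                  (x - A) - (H * ((j - + 1) * (j - + 1 - + 1)) + C * (j - + 1)) ≡ (x - (H * (j * (j - + 1)) + C * j)) - S * (D - (N + j) + + 1)
    instantiate x N j H C C' S D A refl refl refl refl = solved x N j H C

  shift-right : ∀ x N j → (x - + (c' ℕ.+ s ℕ.* N)) - expo (j + + 1) ≡ (x - expo j) - Q ((+ N + j) + + 1)
  shift-right x N j = instantiate x (+ N) j (+ h) (+ c) (+ c') (+ s) (+ (c' ℕ.+ s ℕ.* N))
                                  c'≡2h-c s≡c+c' (factorExponent c' N)
    where
    solved : ∀ (x N j H C : ℤ) → (x - (((H + H) - C) + (C + ((H + H) - C)) * N)) - (H * ((j + + 1) * (j + + 1 - + 1)) + C * (j + + 1))
                               ≡ (x - (H * (j * (j - + 1)) + C * j)) - (C + ((H + H) - C)) * ((N + j) + + 1)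
    solved = solve-∀
    instantiate : ∀ (x N j H C C' S A : ℤ) → C' ≡ (H + H) - C → S ≡ C + C' → A ≡ C' + S * N →
                  (x - A) - (H * ((j + + 1) * (j + + 1 - + 1)) + C * (j + + 1)) ≡ (x - (H * (j * (j - + 1)) + C * j)) - S * ((N + j) + + 1)
    instantiate x N j H C C' S A refl refl refl = solved x N j H C

  shift-both : ∀ x N j → ((x - + (c ℕ.+ s ℕ.* N)) - + (c' ℕ.+ s ℕ.* N)) - expo j ≡ (x - expo j) - Q (+ 1 + + double N)
  shift-both x N j = instantiate x (+ N) (expo j) (+ c) (+ c') (+ s) (+ double N) (+ (c ℕ.+ s ℕ.* N)) (+ (c' ℕ.+ s ℕ.* N))
                                 s≡c+c' (double-+ℤ N) (factorExponent c N) (factorExponent c' N)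
    where
    solved : ∀ (x N E C C' : ℤ) → ((x - (C + (C + C') * N)) - (C' + (C + C') * N)) - E ≡ (x - E) - (C + C') * (+ 1 + (N + N))
    solved = solve-∀
    instantiate : ∀ (x N E C C' S D A A' : ℤ) → S ≡ C + C' → D ≡ N + N → A ≡ C + S * N → A' ≡ C' + S * N →
                  ((x - A) - A') - E ≡ (x - E) - S * (+ 1 + D)
    instantiate x N E C C' S D A A' refl refl refl refl = solved x N E C C'

  -- Termwise recurrence, from the double Pascal rule: with a = c + sN and b = c' + sN,
  --   summand_{N+1}(j) = (1 + q^{a+b}) summand_N(j) - ε qᵃ summand_N(j-1) - ε qᵇ summand_N(j+1).
  summand-step : ∀ N j x →
    summand (suc N) j x ≡ summand N j x + summand N j ((x - + (c ℕ.+ s ℕ.* N)) - + (c' ℕ.+ s ℕ.* N))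
                          - ε * summand N (j - + 1) (x - + (c ℕ.+ s ℕ.* N))
                          - ε * summand N (j + + 1) (x - + (c' ℕ.+ s ℕ.* N))
  summand-step N j x = begin
    upow j * gauss (suc (suc n)) (+ suc N + j) y
      ≡⟨ cong (λ t → upow j * gauss (suc (suc n)) t y) (index (+ N) j) ⟩
    upow j * gauss (suc (suc n)) (k + + 1) y
      ≡⟨ cong (upow j *_) (gauss-pascal₂ n k y) ⟩
    upow j * (X₁ + X₂ + X₃ + X₄)
      ≡⟨ from-difference₂ X₁ X₄ (distribute (upow j) (upow (j - + 1)) (upow (j + + 1)) X₁ X₂ X₃ X₄ ε)
                          (upow-pred j) (upow-suc j) ⟩
    upow j * X₂ + upow j * X₃ - ε * (upow (j - + 1) * X₁) - ε * (upow (j + + 1) * X₄)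
      ≡⟨ cong₂ (λ a b → upow j * X₂ + upow j * a - ε * (upow (j - + 1) * b) - ε * (upow (j + + 1) * X₄))
               (cong (gauss n k) (sym (shift-both x N j)))
               (cong₂ (gauss n) (sym (index-pred (+ N) j)) (sym (shift-left x N j))) ⟩
    upow j * X₂ + summand N j w - ε * summand N (j - + 1) x₁ - ε * (upow (j + + 1) * X₄)
      ≡⟨ cong (λ a → upow j * X₂ + summand N j w - ε * summand N (j - + 1) x₁ - ε * (upow (j + + 1) * a))
              (cong₂ (gauss n) (sym (index-suc (+ N) j)) (sym (shift-right x N j))) ⟩
    summand N j x + summand N j w - ε * summand N (j - + 1) x₁ - ε * summand N (j + + 1) x₂ ∎
    where
    n : ℕ
    k y x₁ x₂ w X₁ X₂ X₃ X₄ : ℤ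
    n = double N
    k = + N + j
    y = x - expo j
    x₁ = x - + (c ℕ.+ s ℕ.* N)
    x₂ = x - + (c' ℕ.+ s ℕ.* N)
    w = x₁ - + (c' ℕ.+ s ℕ.* N)
    X₁ = gauss n (k - + 1) (y - Q (+ n - k + + 1))
    X₂ = gauss n k y
    X₃ = gauss n k (y - Q (+ 1 + + n))
    X₄ = gauss n (k + + 1) (y - Q (k + + 1))
    index : ∀ (N j : ℤ) → (+ 1 + N) + j ≡ (N + j) + + 1
    index = solve-∀
    index-pred : ∀ (N j : ℤ) → N + (j - + 1) ≡ (N + j) - + 1
    index-pred = solve-∀
    index-suc : ∀ (N j : ℤ) → N + (j + + 1) ≡ (N + j) + + 1
    index-suc = solve-∀
    distribute : ∀ (p p₋ p₊ X₁ X₂ X₃ X₄ ε : ℤ) →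
                 p * (X₁ + X₂ + X₃ + X₄) - (p * X₂ + p * X₃ - ε * (p₋ * X₁) - ε * (p₊ * X₄))
                 ≡ X₁ * (p - (- ε) * p₋) + X₄ * (p - (- ε) * p₊)
    distribute = solve-∀

  gauss-0-off : ∀ k y → k ≢ + 0 → gauss 0 k y ≡ + 0
  gauss-0-off (+ zero)  y k≢0 = ⊥-elim (k≢0 refl)
  gauss-0-off (+ suc k) y _   = refl
  gauss-0-off -[1+ k ]  y _   = refl

  -- For N = 0 only the term j = 0 survives, and it is 1.
  theta-base : ∀ R x → theta 0 R x ≡ one x
  theta-base R x = begin
    rangeSum φ (- + R) (suc (double R))   ≡⟨ rangeSum-single φ (- + R) (suc (double R)) R (ℕ.s≤s (n≤double R)) others ⟩
    φ (- + R + + R)                       ≡⟨ cong φ (ℤP.+-inverseˡ (+ R)) ⟩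
    + 1 * gauss 0 (+ 0) (x - expo (+ 0))  ≡⟨ cong (λ v → + 1 * gauss 0 (+ 0) (x - v)) expo-zero ⟩
    + 1 * gauss 0 (+ 0) (x - + 0)         ≡⟨ ℤP.*-identityˡ _ ⟩
    one (x - + 0)                         ≡⟨ cong one (ℤP.+-identityʳ x) ⟩
    one x                                 ∎
    where
    φ : ℤ → ℤ
    φ j = summand 0 j x
    recenter : ∀ (i R : ℤ) → i ≡ (- R + i) + R
    recenter = solve-∀
    others : ∀ i → i ℕ.< suc (double R) → i ≢ R → φ (- + R + + i) ≡ + 0
    others i _ i≢R = trans (cong (upow (- + R + + i) *_)
                             (trans (cong (λ k → gauss 0 k (x - expo (- + R + + i))) (ℤP.+-identityˡ (- + R + + i)))
                                    (gauss-0-off _ _ off)))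
                           (ℤP.*-zeroʳ (upow (- + R + + i)))
      where
      off : - + R + + i ≢ + 0
      off eq = i≢R (ℤP.+-injective (trans (recenter (+ i) (+ R)) (trans (cong (_+ + R) eq) (ℤP.+-identityˡ (+ R)))))

  -- Summing summand-step over |j| ≤ R; the shifted sums are recentred because the
  -- summands vanish outside |j| ≤ N < R.
  theta-step : ∀ N R → N ℕ.< R → ∀ x →
    theta (suc N) R x ≡ theta N R x + theta N R ((x - + (c ℕ.+ s ℕ.* N)) - + (c' ℕ.+ s ℕ.* N))
                        - ε * theta N R (x - + (c ℕ.+ s ℕ.* N)) - ε * theta N R (x - + (c' ℕ.+ s ℕ.* N))
  theta-step N R N<R x = begin
    symSum (λ j → summand (suc N) j x) R
      ≡⟨ rangeSum-ext _ _ (- + R) L (λ j → summand-step N j x) ⟩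
    symSum (λ j → summand N j x + summand N j w - ε * summand N (j - + 1) x₁ - ε * summand N (j + + 1) x₂) R
      ≡⟨ rangeSum-linear ε (λ j → summand N j x + summand N j w - ε * summand N (j - + 1) x₁) (λ j → summand N (j + + 1) x₂) (- + R) L ⟩
    symSum (λ j → summand N j x + summand N j w - ε * summand N (j - + 1) x₁) R - ε * symSum (λ j → summand N (j + + 1) x₂) R
      ≡⟨ cong (_- ε * symSum (λ j → summand N (j + + 1) x₂) R)
              (rangeSum-linear ε (λ j → summand N j x + summand N j w) (λ j → summand N (j - + 1) x₁) (- + R) L) ⟩
    symSum (λ j → summand N j x + summand N j w) R - ε * symSum (λ j → summand N (j - + 1) x₁) R
                                                     - ε * symSum (λ j → summand N (j + + 1) x₂) R
      ≡⟨ cong₃ (λ a b d → a - ε * b - ε * d)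
               (rangeSum-+ (λ j → summand N j x) (λ j → summand N j w) (- + R) L) recentre-down recentre-up ⟩
    theta N R x + theta N R w - ε * theta N R x₁ - ε * theta N R x₂ ∎
    where
    L : ℕ
    x₁ x₂ w : ℤ
    L = suc (double R)
    x₁ = x - + (c ℕ.+ s ℕ.* N)
    x₂ = x - + (c' ℕ.+ s ℕ.* N)
    w = x₁ - + (c' ℕ.+ s ℕ.* N)
    cong₃ : ∀ (f : ℤ → ℤ → ℤ → ℤ) {a a' b b' d d'} → a ≡ a' → b ≡ b' → d ≡ d' → f a b d ≡ f a' b' d'
    cong₃ f refl refl refl = refl
    left-end : ∀ (R : ℤ) → - R - + 1 ≡ - (+ 1 + R)
    left-end = solve-∀
    right-end : ∀ (R D : ℤ) → D ≡ R + R → - R + D ≡ R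
    right-end R D refl = right-end-solved R
      where
      right-end-solved : ∀ (R : ℤ) → - R + (R + R) ≡ R
      right-end-solved = solve-∀
    right-end₊ : ∀ (R D : ℤ) → D ≡ R + R → - R + + 1 + D ≡ + 1 + R
    right-end₊ R D refl = right-end₊-solved R
      where
      right-end₊-solved : ∀ (R : ℤ) → - R + + 1 + (R + R) ≡ + 1 + R
      right-end₊-solved = solve-∀
    -N>-R : - + R < - + N
    -N>-R = ℤP.neg-mono-< (ℤ.+<+ N<R)
    recentre-down : symSum (λ j → summand N (j - + 1) x₁) R ≡ theta N R x₁
    recentre-down = symSum-down (λ j → summand N j x₁) R
      (subst (λ j → summand N j x₁ ≡ + 0) (sym (left-end (+ R)))
             (summand-below N _ x₁ (ℤP.neg-mono-< (ℤ.+<+ (ℕP.m<n⇒m<1+n N<R)))))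
      (subst (λ j → summand N j x₁ ≡ + 0) (sym (right-end (+ R) (+ double R) (double-+ℤ R)))
             (summand-above N (+ R) x₁ (ℤ.+<+ N<R)))
    recentre-up : symSum (λ j → summand N (j + + 1) x₂) R ≡ theta N R x₂
    recentre-up = symSum-up (λ j → summand N j x₂) R
      (summand-below N (- + R) x₂ -N>-R)
      (subst (λ j → summand N j x₂ ≡ + 0) (sym (right-end₊ (+ R) (+ double R) (double-+ℤ R)))
             (summand-above N (+ suc R) x₂ (ℤ.+<+ (ℕP.m<n⇒m<1+n N<R))))

  triple-finite : ∀ N R → N ℕ.< R → mulAll (tripleFactors N) one ≈ theta N R
  triple-finite zero    R _   x = sym (theta-base R x)
  triple-finite (suc N) R N<R x = begin
    mulBy ε a (mulBy ε b (mulAll (tripleFactors N) one)) x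
      ≡⟨ mulBy-cong ε a (mulBy-cong ε b (triple-finite N R N<R')) x ⟩
    (T x - ε * T (x - + b)) - ε * (T (x - + a) - ε * T (x - + a - + b))
      ≡⟨ from-difference (T (x - + a - + b)) (expand (T x) (T (x - + a - + b)) (T (x - + a)) (T (x - + b)) ε) ε²≡1 ⟩
    T x + T (x - + a - + b) - ε * T (x - + a) - ε * T (x - + b)
      ≡⟨ sym (theta-step N R N<R' x) ⟩
    theta (suc N) R x ∎
    where
    N<R' : N ℕ.< R
    N<R' = ℕP.<-trans (ℕP.n<1+n N) N<R
    a b : ℕ
    T : Series
    a = c ℕ.+ s ℕ.* N
    b = c' ℕ.+ s ℕ.* N
    T = theta N R
    expand : ∀ (A W X₁ X₂ ε : ℤ) → ((A - ε * X₂) - ε * (X₁ - ε * W)) - (A + W - ε * X₁ - ε * X₂) ≡ W * (ε * ε - + 1)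
    expand = solve-∀

  -- The limit of the finite identity multiplied by (Q ; Q)_{2N} is
  --   (Q ; Q)_∞ ∏_{i≥0} (1 - ε q^{c+si}) (1 - ε q^{c'+si}) = Σ_{j∈ℤ} u^|j| q^{e(j)},
  -- and it is exact up to degree d as soon as 2d ≤ N.
  thetaSeries : ℕ → Series
  thetaSeries N x = symSum (λ j → upow j * one (x - expo j)) (suc N)

  -- e(j) ≥ |j|, so the terms with |j| > d do not reach degree d.
  cast : ∀ a b k d → + (a ℕ.* (b ℕ.* k) ℕ.+ d ℕ.* b) ≡ + a * (+ b * + k) + + d * + b
  cast a b k d = trans (ℤP.pos-+ (a ℕ.* (b ℕ.* k)) (d ℕ.* b))
                       (cong₂ _+_ (trans (ℤP.pos-* a (b ℕ.* k)) (cong (+ a *_) (ℤP.pos-* b k))) (ℤP.pos-* d b))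

  expo-split : ∀ j → ∃ λ r → expo j ≡ + r + + ℤ.∣ j ∣
  expo-split (+ zero)  = 0 , expo-zero
  expo-split (+ suc m) = h ℕ.* (suc m ℕ.* m) ℕ.+ c₀ ℕ.* suc m ,
    trans (solved (+ h) (+ c₀) (+ m)) (cong (_+ + suc m) (sym (cast h (suc m) m c₀)))
    where
    solved : ∀ (H C₀ M : ℤ) → H * ((+ 1 + M) * (+ 1 + M - + 1)) + (+ 1 + C₀) * (+ 1 + M)
                            ≡ (H * ((+ 1 + M) * M) + C₀ * (+ 1 + M)) + (+ 1 + M)
    solved = solve-∀
  expo-split -[1+ m ]  = h ℕ.* (suc m ℕ.* m) ℕ.+ c₀' ℕ.* suc m ,
    trans (from-difference (+ 1 + + m) (solved (+ h) (+ c) (+ c₀') (+ m)) (sym c'≡2h-c))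
          (cong (_+ + suc m) (sym (cast h (suc m) m c₀')))
    where
    solved : ∀ (H C C₀' M : ℤ) →
             (H * (- (+ 1 + M) * (- (+ 1 + M) - + 1)) + C * - (+ 1 + M)) - ((H * ((+ 1 + M) * M) + C₀' * (+ 1 + M)) + (+ 1 + M))
             ≡ (+ 1 + M) * (((H + H) - C) - (+ 1 + C₀'))
    solved = solve-∀

  ∣j∣≤expo : ∀ j → + ℤ.∣ j ∣ ≤ expo j
  ∣j∣≤expo j with expo-split j
  ... | r , eq = subst (+ ℤ.∣ j ∣ ≤_) (sym (trans eq (ℤP.+-comm (+ r) (+ ℤ.∣ j ∣)))) (ℤP.i≤i+j (+ ℤ.∣ j ∣) (+ r))

  expo-nonneg : ∀ j → + 0 ≤ expo j
  expo-nonneg j = ℤP.≤-trans (ℤ.+≤+ ℕ.z≤n) (∣j∣≤expo j)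

  below-multiple : ∀ {d k} → d ℕ.≤ k → + d < + (s ℕ.* suc k)
  below-multiple {d} {k} d≤k = ℤ.+<+ (ℕP.<-≤-trans (ℕ.s≤s d≤k) (ℕP.m≤n*m (suc k) s))

  central-limit : ∀ N d j → d ℕ.+ d ℕ.≤ N → ℤ.∣ j ∣ ℕ.≤ d →
                  mulAll (qPoch (double N)) (gauss (double N) (+ N + j)) ≈[ + d ] one
  central-limit N d (+ m) 2d≤N m≤d =
    gauss-limit (double N) (double N) (N ℕ.+ m) (N ℕ.∸ m) (+ d) sizes k≤2N
                (below-multiple (ℕP.≤-trans d≤N (ℕP.m≤m+n N m)))
                (below-multiple (ℕP.m+n≤o⇒m≤o∸n d (ℕP.≤-trans (ℕP.+-monoʳ-≤ d m≤d) 2d≤N)))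
    where
    d≤N : d ℕ.≤ N
    d≤N = ℕP.≤-trans (ℕP.m≤m+n d d) 2d≤N
    m≤N : m ℕ.≤ N
    m≤N = ℕP.≤-trans m≤d d≤N
    sizes : N ℕ.+ m ℕ.+ (N ℕ.∸ m) ≡ double N
    sizes = trans (ℕP.+-assoc N m (N ℕ.∸ m)) (trans (cong (N ℕ.+_) (ℕP.m+[n∸m]≡n m≤N)) (sym (double-+ N)))
    k≤2N : N ℕ.+ m ℕ.≤ double N
    k≤2N = subst (N ℕ.+ m ℕ.≤_) (sym (double-+ N)) (ℕP.+-monoʳ-≤ N m≤N)
  central-limit N d -[1+ m ] 2d≤N m<d =
    subst (λ k → mulAll (qPoch (double N)) (gauss (double N) k) ≈[ + d ] one) (sym (ℤP.⊖-≥ m<N))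
      (gauss-limit (double N) (double N) (N ℕ.∸ suc m) (N ℕ.+ suc m) (+ d) sizes
                   (ℕP.≤-trans (ℕP.m∸n≤m N (suc m)) (n≤double N))
                   (below-multiple (ℕP.m+n≤o⇒m≤o∸n d (ℕP.≤-trans (ℕP.+-monoʳ-≤ d m<d) 2d≤N)))
                   (below-multiple (ℕP.≤-trans d≤N (ℕP.m≤m+n N (suc m)))))
    where
    d≤N : d ℕ.≤ N
    d≤N = ℕP.≤-trans (ℕP.m≤m+n d d) 2d≤N
    m<N : suc m ℕ.≤ N
    m<N = ℕP.≤-trans m<d d≤N
    sizes : N ℕ.∸ suc m ℕ.+ (N ℕ.+ suc m) ≡ double N
    sizes = begin
      N ℕ.∸ suc m ℕ.+ (N ℕ.+ suc m) ≡⟨ cong (N ℕ.∸ suc m ℕ.+_) (ℕP.+-comm N (suc m)) ⟩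
      N ℕ.∸ suc m ℕ.+ (suc m ℕ.+ N) ≡⟨ sym (ℕP.+-assoc (N ℕ.∸ suc m) (suc m) N) ⟩
      N ℕ.∸ suc m ℕ.+ suc m ℕ.+ N   ≡⟨ cong (ℕ._+ N) (ℕP.m∸n+n≡m m<N) ⟩
      N ℕ.+ N                       ≡⟨ sym (double-+ N) ⟩
      double N                      ∎

  summand-limit : ∀ N d → d ℕ.+ d ℕ.≤ N → ∀ j x → x ≤ + d →
                  upow j * mulAll (qPoch (double N)) (gauss (double N) (+ N + j)) (x - expo j) ≡ upow j * one (x - expo j)
  summand-limit N d 2d≤N j x x≤d with ℤ.∣ j ∣ ℕP.≤? d
  ... | yes ∣j∣≤d = cong (upow j *_) (central-limit N d j 2d≤N ∣j∣≤d (x - expo j) (shift-le-nonneg (expo-nonneg j) x≤d))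
  ... | no  ∣j∣≰d = cong (upow j *_) (trans (vanish (mulAll-power (qPoch (double N)) (gauss-power (double N) (+ N + j))) negative)
                                            (sym (vanish one-power negative)))
    where
    negative : x - expo j < + 0
    negative = shift-neg x≤d (ℤP.<-≤-trans (ℤ.+<+ (ℕP.≰⇒> ∣j∣≰d)) (∣j∣≤expo j))

  triple-truncated : ∀ N d → d ℕ.+ d ℕ.≤ N →
                     mulAll (qPoch (double N)) (mulAll (tripleFactors N) one) ≈[ + d ] thetaSeries N
  triple-truncated N d 2d≤N x x≤d = begin
    mulAll qN (mulAll (tripleFactors N) one) x
      ≡⟨ mulAll-cong qN (triple-finite N (suc N) (ℕP.n<1+n N)) x ⟩
    mulAll qN (theta N (suc N)) x
      ≡⟨ mulAll-seriesSum qN (summand N) (- + suc N) (suc (double (suc N))) x ⟩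
    symSum (λ j → mulAll qN (summand N j) x) (suc N)
      ≡⟨ rangeSum-ext _ _ (- + suc N) (suc (double (suc N))) (λ j →
           trans (mulAll-scale-shift qN (upow j) (expo j) (gauss (double N) (+ N + j)) x)
                 (summand-limit N d 2d≤N j x x≤d)) ⟩
    thetaSeries N x ∎
    where
    qN : List Factor
    qN = qPoch (double N)

sumBelow : (ℕ → ℕ) → ℕ → ℕ
sumBelow g b = sum (map g (upTo b))

sumBelow-snoc : ∀ g b → sumBelow g (suc b) ≡ sumBelow g b ℕ.+ g b
sumBelow-snoc g b = begin
  sum (map g (upTo (suc b)))            ≡⟨ cong (λ l → sum (map g l)) (sym (ListP.upTo-∷ʳ b)) ⟩
  sum (map g (upTo b ++ (b ∷ [])))      ≡⟨ cong sum (ListP.map-++ g (upTo b) (b ∷ [])) ⟩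
  sum (map g (upTo b) ++ (g b ∷ []))    ≡⟨ SumP.sum-++ (map g (upTo b)) (g b ∷ []) ⟩
  sum (map g (upTo b)) ℕ.+ (g b ℕ.+ 0)  ≡⟨ cong (sum (map g (upTo b)) ℕ.+_) (ℕP.+-identityʳ (g b)) ⟩
  sumBelow g b ℕ.+ g b                  ∎

sumBelow-cong : ∀ g g' b → (∀ i → g i ≡ g' i) → sumBelow g b ≡ sumBelow g' b
sumBelow-cong g g' b p = cong sum (ListP.map-cong p (upTo b))

sumBelow-pad : ∀ g k m → (∀ i → k ℕ.≤ i → g i ≡ 0) → sumBelow g (m ℕ.+ k) ≡ sumBelow g k
sumBelow-pad g k zero    p = refl
sumBelow-pad g k (suc m) p =
  trans (sumBelow-snoc g (m ℕ.+ k))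
        (trans (cong₂ ℕ._+_ (sumBelow-pad g k m p) (p (m ℕ.+ k) (ℕP.m≤n+m k m))) (ℕP.+-identityʳ _))

length-concatMap : ∀ {X : Set} (G : ℕ → List X) xs → length (concatMap G xs) ≡ sum (map (λ i → length (G i)) xs)
length-concatMap G []       = refl
length-concatMap G (x ∷ xs) = trans (ListP.length-++ (G x)) (cong (length (G x) ℕ.+_) (length-concatMap G xs))

length-if : ∀ {X : Set} (β : Bool) (p : X) (xs : List (List X)) →
            length (if β then map (p ∷_) xs else []) ≡ (if β then length xs else 0)
length-if true  p xs = ListP.length-map (p ∷_) xs
length-if false p xs = refl

countParts : ℕ → ℕ → ℕ → ℕ
countParts f n b = length (oddPartsBounded f n b)

-- countLargest f n i: the number of those whose largest part is 2i + 1.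
countLargest : ℕ → ℕ → ℕ → ℕ
countLargest f n i = if does (2 ℕ.* i ℕ.+ 1 ℕ.≤? n) then countParts f (n ℕ.∸ (2 ℕ.* i ℕ.+ 1)) i else 0

countLargest-fits : ∀ f n i → 2 ℕ.* i ℕ.+ 1 ℕ.≤ n → countLargest f n i ≡ countParts f (n ℕ.∸ (2 ℕ.* i ℕ.+ 1)) i
countLargest-fits f n i fits =
  cong (λ β → if β then countParts f (n ℕ.∸ (2 ℕ.* i ℕ.+ 1)) i else 0) (dec-true (2 ℕ.* i ℕ.+ 1 ℕ.≤? n) fits)

countLargest-too-big : ∀ f n i → ¬ (2 ℕ.* i ℕ.+ 1 ℕ.≤ n) → countLargest f n i ≡ 0
countLargest-too-big f n i big =
  cong (λ β → if β then countParts f (n ℕ.∸ (2 ℕ.* i ℕ.+ 1)) i else 0) (dec-false (2 ℕ.* i ℕ.+ 1 ℕ.≤? n) big)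

-- Classifying partitions by their largest part.
countParts-largest : ∀ f n b → countParts (suc f) (suc n) b ≡ sumBelow (countLargest f (suc n)) (suc b)
countParts-largest f n b =
  trans (length-concatMap byLargest (upTo (suc b)))
        (cong sum (ListP.map-cong (λ i → length-if (does (2 ℕ.* i ℕ.+ 1 ℕ.≤? suc n)) (2 ℕ.* i ℕ.+ 1)
                                                   (oddPartsBounded f (suc n ℕ.∸ (2 ℕ.* i ℕ.+ 1)) i))
                                  (upTo (suc b))))
  where
  byLargest : ℕ → List (List ℕ)
  byLargest i = if does (2 ℕ.* i ℕ.+ 1 ℕ.≤? suc n)
                then map ((2 ℕ.* i ℕ.+ 1) ∷_) (oddPartsBounded f (suc n ℕ.∸ (2 ℕ.* i ℕ.+ 1)) i) else []

countParts-empty : ∀ f b → countParts f 0 b ≡ 1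
countParts-empty zero    b = refl
countParts-empty (suc f) b = refl

remainder≤ : ∀ n i → suc n ℕ.∸ (2 ℕ.* i ℕ.+ 1) ℕ.≤ n
remainder≤ n i = subst (λ t → suc n ℕ.∸ t ℕ.≤ n) (ℕP.+-comm 1 (2 ℕ.* i)) (ℕP.m∸n≤m n (2 ℕ.* i))

countParts-fuel : ∀ f f' n b → n ℕ.≤ f → n ℕ.≤ f' → countParts f n b ≡ countParts f' n b
countParts-fuel f f' zero b _ _ = trans (countParts-empty f b) (sym (countParts-empty f' b))
countParts-fuel (suc f) (suc f') (suc n) b (ℕ.s≤s n≤f) (ℕ.s≤s n≤f') =
  trans (countParts-largest f n b) (trans (sumBelow-cong _ _ (suc b) same) (sym (countParts-largest f' n b)))
  where
  same : ∀ i → countLargest f (suc n) i ≡ countLargest f' (suc n) i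
  same i with 2 ℕ.* i ℕ.+ 1 ℕ.≤? suc n
  ... | yes fits = trans (countLargest-fits f (suc n) i fits)
                   (trans (countParts-fuel f f' _ i (ℕP.≤-trans (remainder≤ n i) n≤f) (ℕP.≤-trans (remainder≤ n i) n≤f'))
                          (sym (countLargest-fits f' (suc n) i fits)))
  ... | no big = trans (countLargest-too-big f (suc n) i big) (sym (countLargest-too-big f' (suc n) i big))

boundedCount : ℕ → ℕ → ℕ
boundedCount n b = countParts n n b

boundedSeries : ℕ → Series
boundedSeries b (+ n)    = + boundedCount n b
boundedSeries b -[1+ _ ] = + 0

boundedSeries-power : ∀ b → IsPowerSeries (boundedSeries b)
boundedSeries-power b = powerSeries λ _ → refl

countLargest-series : ∀ n i → + countLargest n (suc n) i ≡ boundedSeries i (+ suc n - + (2 ℕ.* i ℕ.+ 1))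
countLargest-series n i with 2 ℕ.* i ℕ.+ 1 ℕ.≤? suc n
... | yes fits = begin
  + countLargest n (suc n) i                        ≡⟨ cong +_ (countLargest-fits n (suc n) i fits) ⟩
  + countParts n (suc n ℕ.∸ (2 ℕ.* i ℕ.+ 1)) i      ≡⟨ cong +_ (countParts-fuel n _ _ i (remainder≤ n i) ℕP.≤-refl) ⟩
  boundedSeries i (+ (suc n ℕ.∸ (2 ℕ.* i ℕ.+ 1)))  ≡⟨ cong (boundedSeries i) (sym (trans (ℤP.m-n≡m⊖n (suc n) (2 ℕ.* i ℕ.+ 1)) (ℤP.⊖-≥ fits))) ⟩
  boundedSeries i (+ suc n - + (2 ℕ.* i ℕ.+ 1))     ∎
... | no big = trans (cong +_ (countLargest-too-big n (suc n) i big))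
                     (sym (vanish (boundedSeries-power i) (shift-neg {a = + (2 ℕ.* i ℕ.+ 1)} ℤP.≤-refl (ℤ.+<+ (ℕP.≰⇒> big)))))

-- (1 - q^{2b+1}) removes the partitions whose largest part is 2b + 1.
bounded-step : ∀ b n → mulBy (+ 1) (2 ℕ.* b ℕ.+ 1) (boundedSeries b) (+ suc n)
                       ≡ + sumBelow (countLargest n (suc n)) b
bounded-step b n = begin
  + boundedCount (suc n) b - + 1 * X
    ≡⟨ cong (λ v → + v - + 1 * X) (trans (countParts-largest n n b) (sumBelow-snoc g b)) ⟩
  + (sumBelow g b ℕ.+ g b) - + 1 * X
    ≡⟨ cong (_- + 1 * X) (trans (ℤP.pos-+ (sumBelow g b) (g b)) (cong (λ t → + sumBelow g b + t) (countLargest-series n b))) ⟩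
  (+ sumBelow g b + X) - + 1 * X
    ≡⟨ cancel (+ sumBelow g b) X ⟩
  + sumBelow g b ∎
  where
  g : ℕ → ℕ
  g = countLargest n (suc n)
  X : ℤ
  X = boundedSeries b (+ suc n - + (2 ℕ.* b ℕ.+ 1))
  cancel : ∀ (A X : ℤ) → (A + X) - + 1 * X ≡ A
  cancel = solve-∀

bounded-base : mulBy (+ 1) 1 (boundedSeries 0) ≈ one
bounded-base -[1+ m ]  = negative-zero (mulBy-power (+ 1) 1 (boundedSeries-power 0)) m
bounded-base (+ zero)  = refl
bounded-base (+ suc n) = bounded-step 0 n

bounded-succ : ∀ b → mulBy (+ 1) (2 ℕ.* suc b ℕ.+ 1) (boundedSeries (suc b)) ≈ boundedSeries b
bounded-succ b -[1+ m ]  = negative-zero (mulBy-power (+ 1) (2 ℕ.* suc b ℕ.+ 1) (boundedSeries-power (suc b))) m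
bounded-succ b (+ zero)  = cong (λ v → + 1 - + 1 * v) (vanish (boundedSeries-power (suc b)) {x = + 0 - + (2 ℕ.* suc b ℕ.+ 1)} ℤ.-<+)
bounded-succ b (+ suc n) = trans (bounded-step (suc b) n) (cong +_ (sym (countParts-largest n n b)))

oddFactors : ℕ → List Factor
oddFactors zero    = []
oddFactors (suc m) = (+ 1 , 2 ℕ.* m ℕ.+ 1) ∷ oddFactors m

oddFactors-cancellable : ∀ m → Cancellable (oddFactors m)
oddFactors-cancellable zero    = []
oddFactors-cancellable (suc m) = subst (1 ℕ.≤_) (ℕP.+-comm 1 (2 ℕ.* m)) (ℕ.s≤s ℕ.z≤n) ∷ oddFactors-cancellable m

oddFactors-bounded : ∀ b → mulAll (oddFactors (suc b)) (boundedSeries b) ≈ one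
oddFactors-bounded zero    = bounded-base
oddFactors-bounded (suc b) =
  ≈-trans (mulBy-mulAll (+ 1) (2 ℕ.* suc b ℕ.+ 1) (oddFactors (suc b)) (boundedSeries (suc b)))
          (≈-trans (mulAll-cong (oddFactors (suc b)) (bounded-succ b)) (oddFactors-bounded b))

boundedCount-bound : ∀ n b b' → n ℕ.≤ 2 ℕ.* b ℕ.+ 1 → b ℕ.≤ b' → boundedCount n b ≡ boundedCount n b'
boundedCount-bound zero    b b' _      _    = refl
boundedCount-bound (suc n) b b' n≤2b+1 b≤b' = begin
  boundedCount (suc n) b       ≡⟨ countParts-largest n n b ⟩
  sumBelow g (suc b)           ≡⟨ sym (sumBelow-pad g (suc b) (b' ℕ.∸ b) none) ⟩
  sumBelow g (b' ℕ.∸ b ℕ.+ suc b) ≡⟨ cong (sumBelow g) (trans (ℕP.+-suc (b' ℕ.∸ b) b) (cong suc (ℕP.m∸n+n≡m b≤b'))) ⟩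
  sumBelow g (suc b')          ≡⟨ sym (countParts-largest n n b') ⟩
  boundedCount (suc n) b'      ∎
  where
  g : ℕ → ℕ
  g = countLargest n (suc n)
  double-suc : ∀ b → suc (2 ℕ.* b ℕ.+ 1) ≡ 2 ℕ.* suc b
  double-suc = ℕSolver.solve-∀
  none : ∀ i → suc b ℕ.≤ i → g i ≡ 0
  none i b<i = countLargest-too-big n (suc n) i λ fits →
    ℕP.<-irrefl refl (ℕP.≤-trans (ℕ.s≤s fits) (ℕP.≤-trans (ℕ.s≤s n≤2b+1) large))
    where
    large : suc (2 ℕ.* b ℕ.+ 1) ℕ.≤ 2 ℕ.* i ℕ.+ 1
    large = ℕP.≤-trans (ℕP.≤-reflexive (double-suc b)) (ℕP.≤-trans (ℕP.*-monoʳ-≤ 2 b<i) (ℕP.m≤m+n (2 ℕ.* i) 1))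

po-bounded : ∀ b → poℤ ≈[ + (2 ℕ.* b ℕ.+ 1) ] boundedSeries b
po-bounded b -[1+ m ] _          = refl
po-bounded b (+ n)    (ℤ.+≤+ n≤) with ℕP.≤-total n b
... | inj₁ n≤b = cong +_ (boundedCount-bound n n b (ℕP.≤-trans (ℕP.m≤n*m n 2) (ℕP.m≤m+n (2 ℕ.* n) 1)) n≤b)
... | inj₂ b≤n = cong +_ (sym (boundedCount-bound n b n n≤ b≤n))

oddFactors-po : ∀ b → mulAll (oddFactors (suc b)) poℤ ≈[ + (2 ℕ.* b ℕ.+ 1) ] one
oddFactors-po b = ≈[]-trans (mulAll-cong[] (oddFactors (suc b)) (po-bounded b)) (≈⇒≈[] _ (oddFactors-bounded b))

po-power : IsPowerSeries poℤ
po-power = powerSeries λ _ → refl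

-- The exponents j(3j-2) and j(3j+2) of the statement, and multiplication by the polynomial
--   θ_R(q) = 1 + Σ_{j=1}^{R} (-1)ʲ (q^{j(3j-2)} + q^{j(3j+2)}),
-- so that lhs n is the coefficient of qⁿ in θ_{n+1}(q) · Σₘ p_o(m) qᵐ.
α β : ℕ → ℤ
α j = + j * (+ (3 ℕ.* j) - + 2)
β j = + (j ℕ.* (3 ℕ.* j ℕ.+ 2))

thetaTerm : Series → ℤ → ℕ → ℤ
thetaTerm f x j = sign j * (f (x - α j) + f (x - β j))

thetaTail : Series → ℤ → ℕ → ℤ
thetaTail f x zero    = + 0
thetaTail f x (suc R) = thetaTail f x R + thetaTerm f x (suc R)

mulTheta : ℕ → Series → Series
mulTheta R f x = f x + thetaTail f x R

lhs-mulTheta : ∀ n → lhs n ≡ mulTheta (suc n) poℤ (+ n)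
lhs-mulTheta n = cong (λ t → poℤ (+ n) + t) (tail (suc n))
  where
  tail : ∀ R → sumTerms n R ≡ thetaTail poℤ (+ n) R
  tail zero    = refl
  tail (suc R) = cong (_+ term n (suc R)) (tail R)

α-≥ : ∀ j → + suc j ≤ α (suc j)
α-≥ j = subst (+ suc j ≤_) (sym (trans (cong (λ t → + suc j * (t - + 2)) (ℤP.pos-* 3 (suc j))) (solved (+ j))))
              (ℤP.i≤i+j (+ 1 + + j) ((+ 1 + + j) * (+ 3 * + j)) ⦃ nonneg ⦄)
  where
  solved : ∀ (J : ℤ) → (+ 1 + J) * (+ 3 * (+ 1 + J) - + 2) ≡ (+ 1 + J) + (+ 1 + J) * (+ 3 * J)
  solved = solve-∀
  nonneg : ℤ.NonNegative ((+ 1 + + j) * (+ 3 * + j))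
  nonneg = subst ℤ.NonNegative (trans (ℤP.pos-* (suc j) (3 ℕ.* j)) (cong (+ suc j *_) (ℤP.pos-* 3 j))) _

β-≥ : ∀ j → + suc j ≤ β (suc j)
β-≥ j = ℤ.+≤+ (subst (suc j ℕ.≤_) (sym (split j)) (ℕP.m≤m+n (suc j) _))
  where
  split : ∀ j → suc j ℕ.* (3 ℕ.* suc j ℕ.+ 2) ≡ suc j ℕ.+ suc j ℕ.* (3 ℕ.* suc j ℕ.+ 1)
  split = ℕSolver.solve-∀

α-nonneg : ∀ j → + 0 ≤ α (suc j)
α-nonneg j = ℤP.≤-trans (ℤ.+≤+ ℕ.z≤n) (α-≥ j)

β-nonneg : ∀ j → + 0 ≤ β (suc j)
β-nonneg j = ℤP.≤-trans (ℤ.+≤+ ℕ.z≤n) (β-≥ j)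

mulTheta-cong[] : ∀ R {f g d} → f ≈[ d ] g → mulTheta R f ≈[ d ] mulTheta R g
mulTheta-cong[] R {f} {g} p x x≤d = cong₂ _+_ (p x x≤d) (tail R)
  where
  tail : ∀ R → thetaTail f x R ≡ thetaTail g x R
  tail zero    = refl
  tail (suc R) = cong₂ _+_ (tail R)
    (cong (sign (suc R) *_) (cong₂ _+_ (p _ (shift-le-nonneg (α-nonneg R) x≤d)) (p _ (shift-le-nonneg (β-nonneg R) x≤d))))

private
  swap : ∀ (x a b : ℤ) → x - b - a ≡ x - a - b
  swap = solve-∀
  pull-sign : ∀ (σ e u v w z : ℤ) → σ * ((u - e * w) + (v - e * z)) ≡ σ * (u + v) - e * (σ * (w + z))
  pull-sign = solve-∀
  interchange : ∀ (e A B C D : ℤ) → A + C - e * (B + D) ≡ (A - e * B) + (C - e * D)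
  interchange = solve-∀

thetaTail-mulBy : ∀ e a f x R → thetaTail (mulBy e a f) x R ≡ thetaTail f x R - e * thetaTail f (x - + a) R
thetaTail-mulBy e a f x zero    = sym (cong (λ t → + 0 - t) (ℤP.*-zeroʳ e))
thetaTail-mulBy e a f x (suc R) = begin
  thetaTail (mulBy e a f) x R + thetaTerm (mulBy e a f) x (suc R)
    ≡⟨ cong₂ _+_ (thetaTail-mulBy e a f x R) term-mulBy ⟩
  (thetaTail f x R - e * thetaTail f (x - + a) R) + (thetaTerm f x (suc R) - e * thetaTerm f (x - + a) (suc R))
    ≡⟨ sym (interchange e (thetaTail f x R) (thetaTail f (x - + a) R) (thetaTerm f x (suc R)) (thetaTerm f (x - + a) (suc R))) ⟩
  thetaTail f x (suc R) - e * thetaTail f (x - + a) (suc R) ∎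
  where
  term-mulBy : thetaTerm (mulBy e a f) x (suc R) ≡ thetaTerm f x (suc R) - e * thetaTerm f (x - + a) (suc R)
  term-mulBy = trans (cong₂ (λ p q → sign (suc R) * ((f (x - α (suc R)) - e * f p) + (f (x - β (suc R)) - e * f q)))
                            (swap x (+ a) (α (suc R))) (swap x (+ a) (β (suc R))))
                     (pull-sign (sign (suc R)) e (f (x - α (suc R))) (f (x - β (suc R)))
                                (f (x - + a - α (suc R))) (f (x - + a - β (suc R))))

mulAll-mulTheta : ∀ L R f → mulAll L (mulTheta R f) ≈ mulTheta R (mulAll L f)
mulAll-mulTheta []            R f = ≈-refl
mulAll-mulTheta ((e , a) ∷ L) R f = ≈-trans (mulBy-cong e a (mulAll-mulTheta L R f)) commute
  where
  g : Series
  g = mulAll L f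
  commute : mulBy e a (mulTheta R g) ≈ mulTheta R (mulBy e a g)
  commute x = trans (interchange e (g x) (g (x - + a)) (thetaTail g x R) (thetaTail g (x - + a) R))
                    (cong (λ t → mulBy e a g x + t) (sym (thetaTail-mulBy e a g x R)))

thetaTail-stable : ∀ {f} → IsPowerSeries f → ∀ d x → x ≤ + d → ∀ R → d ℕ.< R → ∀ m →
                   thetaTail f x (m ℕ.+ R) ≡ thetaTail f x R
thetaTail-stable pf d x x≤d R d<R zero    = refl
thetaTail-stable {f} pf d x x≤d R d<R (suc m) = begin
  thetaTail f x (m ℕ.+ R) + sign (suc (m ℕ.+ R)) * (f (x - α (suc (m ℕ.+ R))) + f (x - β (suc (m ℕ.+ R))))
    ≡⟨ cong₂ (λ p q → p + sign (suc (m ℕ.+ R)) * q) (thetaTail-stable pf d x x≤d R d<R m)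
             (cong₂ _+_ (vanish pf (shift-neg x≤d (ℤP.<-≤-trans d<j (α-≥ (m ℕ.+ R)))))
                        (vanish pf (shift-neg x≤d (ℤP.<-≤-trans d<j (β-≥ (m ℕ.+ R)))))) ⟩
  thetaTail f x R + sign (suc (m ℕ.+ R)) * + 0 ≡⟨ cong (λ t → thetaTail f x R + t) (ℤP.*-zeroʳ (sign (suc (m ℕ.+ R)))) ⟩
  thetaTail f x R + + 0                        ≡⟨ ℤP.+-identityʳ _ ⟩
  thetaTail f x R                              ∎
  where
  d<j : + d < + suc (m ℕ.+ R)
  d<j = ℤ.+<+ (ℕP.<-≤-trans d<R (ℕP.≤-trans (ℕP.m≤n+m R m) (ℕP.n≤1+n _)))

mulTheta-range : ∀ {f} → IsPowerSeries f → ∀ d R R' → d ℕ.< R → R ℕ.≤ R' → ∀ x → x ≤ + d →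
                 mulTheta R' f x ≡ mulTheta R f x
mulTheta-range {f} pf d R R' d<R R≤R' x x≤d =
  cong (λ t → f x + t) (trans (cong (thetaTail f x) (sym (ℕP.m∸n+n≡m R≤R'))) (thetaTail-stable pf d x x≤d R d<R (R' ℕ.∸ R)))

mulTheta-power : ∀ R {f} → IsPowerSeries f → IsPowerSeries (mulTheta R f)
mulTheta-power R {f} pf = powerSeries λ m → cong₂ _+_ (negative-zero pf m) (tail m R)
  where
  tail : ∀ m R → thetaTail f -[1+ m ] R ≡ + 0
  tail m zero    = refl
  tail m (suc R) = begin
    thetaTail f -[1+ m ] R + sign (suc R) * (f (-[1+ m ] - α (suc R)) + f (-[1+ m ] - β (suc R)))
      ≡⟨ cong₂ (λ p q → p + sign (suc R) * q) (tail m R)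
               (cong₂ _+_ (vanish pf (shift-neg {x = -[1+ m ]} {a = α (suc R)} ℤP.≤-refl (ℤP.<-≤-trans ℤ.-<+ (α-nonneg R))))
                          (vanish pf (shift-neg {x = -[1+ m ]} {a = β (suc R)} ℤP.≤-refl (ℤP.<-≤-trans ℤ.-<+ (β-nonneg R))))) ⟩
    + 0 + sign (suc R) * + 0 ≡⟨ cong (λ t → + 0 + t) (ℤP.*-zeroʳ (sign (suc R))) ⟩
    + 0 ∎

-- The two instances of the triple product used below.
--   (h, c, c', ε) = (3, 1, 5, 1):  exponents e(j) = 3j² - 2j, signs (-1)ʲ; the theta series
--     is θ(q) = Σ_{j∈ℤ} (-1)ʲ q^{j(3j+2)} of the statement;
--   (h, c, c', ε) = (6, 3, 9, -1): exponents e(j) = 6j² - 3j, signs 1; the theta series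
--     is Σ_{k≥0} q^{3k(k+1)/2}.
module SignedJTP     = TripleProduct 3 0 4 refl (+ 1) refl
module TriangularJTP = TripleProduct 6 2 8 refl (- + 1) refl

sign-power : ∀ n → sign n ≡ (- + 1) ^ n
sign-power zero          = refl
sign-power (suc zero)    = refl
sign-power (suc (suc n)) = trans (sign-power n) (twice-negated ((- + 1) ^ n))
  where
  twice-negated : ∀ (x : ℤ) → x ≡ (- + 1) * ((- + 1) * x)
  twice-negated = solve-∀

signed-expo-pos : ∀ m → SignedJTP.expo (+ suc m) ≡ α (suc m)
signed-expo-pos m = trans (solved (+ m)) (cong (λ t → + suc m * (t - + 2)) (sym (ℤP.pos-* 3 (suc m))))
  where
  solved : ∀ (M : ℤ) → + 3 * ((+ 1 + M) * (+ 1 + M - + 1)) + + 1 * (+ 1 + M) ≡ (+ 1 + M) * (+ 3 * (+ 1 + M) - + 2)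
  solved = solve-∀

signed-expo-neg : ∀ m → SignedJTP.expo -[1+ m ] ≡ β (suc m)
signed-expo-neg m = trans (solved (+ m)) (sym cast)
  where
  solved : ∀ (M : ℤ) → + 3 * (- (+ 1 + M) * (- (+ 1 + M) - + 1)) + + 1 * - (+ 1 + M) ≡ (+ 1 + M) * (+ 3 * (+ 1 + M) + + 2)
  solved = solve-∀
  cast : + (suc m ℕ.* (3 ℕ.* suc m ℕ.+ 2)) ≡ (+ 1 + + m) * (+ 3 * (+ 1 + + m) + + 2)
  cast = trans (ℤP.pos-* (suc m) _) (cong (+ suc m *_) (trans (ℤP.pos-+ (3 ℕ.* suc m) 2) (cong (_+ + 2) (ℤP.pos-* 3 (suc m)))))

mulTheta-one : ∀ N → mulTheta (suc N) one ≈ SignedJTP.thetaSeries N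
mulTheta-one N x = sym (begin
  symSum φ (suc N)                  ≡⟨ symSum-pairs φ (suc N) ⟩
  φ (+ 0) + pairSum φ (suc N)       ≡⟨ cong₂ _+_ centre (pairs (suc N)) ⟩
  mulTheta (suc N) one x            ∎)
  where
  open SignedJTP using (upow; expo)
  φ : ℤ → ℤ
  φ j = upow j * one (x - expo j)
  centre : φ (+ 0) ≡ one x
  centre = trans (ℤP.*-identityˡ _) (cong one (trans (cong (λ t → x - t) SignedJTP.expo-zero) (ℤP.+-identityʳ x)))
  pairs : ∀ R → pairSum φ R ≡ thetaTail one x R
  pairs zero    = refl
  pairs (suc R) = cong₂ _+_ (pairs R) (begin
    upow (+ suc R) * one (x - expo (+ suc R)) + upow -[1+ R ] * one (x - expo -[1+ R ])
      ≡⟨ cong₂ (λ p q → upow (+ suc R) * one (x - p) + upow -[1+ R ] * one (x - q)) (signed-expo-pos R) (signed-expo-neg R) ⟩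
    (- + 1) ^ suc R * one (x - α (suc R)) + (- + 1) ^ suc R * one (x - β (suc R))
      ≡⟨ sym (ℤP.*-distribˡ-+ ((- + 1) ^ suc R) _ _) ⟩
    (- + 1) ^ suc R * (one (x - α (suc R)) + one (x - β (suc R)))
      ≡⟨ cong (_* (one (x - α (suc R)) + one (x - β (suc R)))) (sym (sign-power (suc R))) ⟩
    thetaTerm one x (suc R) ∎)

tri : ℕ → ℕ
tri zero    = 0
tri (suc k) = tri k ℕ.+ 3 ℕ.* suc k

tri-closed : ∀ k → 2 ℕ.* tri k ≡ 3 ℕ.* (k ℕ.* suc k)
tri-closed zero    = refl
tri-closed (suc k) =
  trans (ℕP.*-distribˡ-+ 2 (tri k) (3 ℕ.* suc k)) (trans (cong (ℕ._+ 2 ℕ.* (3 ℕ.* suc k)) (tri-closed k)) (step k))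
  where
  step : ∀ k → 3 ℕ.* (k ℕ.* suc k) ℕ.+ 2 ℕ.* (3 ℕ.* suc k) ≡ 3 ℕ.* (suc k ℕ.* suc (suc k))
  step = ℕSolver.solve-∀

tri-odd : ∀ m → tri (suc (double m)) ≡ 3 ℕ.* (suc m ℕ.* suc (2 ℕ.* m))
tri-odd m = ℕP.*-cancelˡ-≡ _ _ 2 (trans (tri-closed (suc (double m))) (rearrange m (double m) (double-+ m)))
  where
  solved : ∀ m → 3 ℕ.* (suc (m ℕ.+ m) ℕ.* suc (suc (m ℕ.+ m))) ≡ 2 ℕ.* (3 ℕ.* (suc m ℕ.* suc (2 ℕ.* m)))
  solved = ℕSolver.solve-∀
  rearrange : ∀ m D → D ≡ m ℕ.+ m → 3 ℕ.* (suc D ℕ.* suc (suc D)) ≡ 2 ℕ.* (3 ℕ.* (suc m ℕ.* suc (2 ℕ.* m)))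
  rearrange m _ refl = solved m

tri-even : ∀ m → tri (suc (suc (double m))) ≡ 3 ℕ.* (suc m ℕ.* (2 ℕ.* m ℕ.+ 3))
tri-even m = ℕP.*-cancelˡ-≡ _ _ 2 (trans (tri-closed (suc (suc (double m)))) (rearrange m (double m) (double-+ m)))
  where
  solved : ∀ m → 3 ℕ.* (suc (suc (m ℕ.+ m)) ℕ.* suc (suc (suc (m ℕ.+ m)))) ≡ 2 ℕ.* (3 ℕ.* (suc m ℕ.* (2 ℕ.* m ℕ.+ 3)))
  solved = ℕSolver.solve-∀
  rearrange : ∀ m D → D ≡ m ℕ.+ m → 3 ℕ.* (suc (suc D) ℕ.* suc (suc (suc D))) ≡ 2 ℕ.* (3 ℕ.* (suc m ℕ.* (2 ℕ.* m ℕ.+ 3)))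
  rearrange m _ refl = solved m

tri-step : ∀ k → tri k ℕ.< tri (suc k)
tri-step k = ℕP.m<m+n (tri k) (ℕ.s≤s ℕ.z≤n)

tri-strict : ∀ k m → tri k ℕ.< tri (suc (m ℕ.+ k))
tri-strict k zero    = tri-step k
tri-strict k (suc m) = ℕP.<-trans (tri-strict k m) (tri-step (suc (m ℕ.+ k)))

tri-mono : ∀ {k k'} → k ℕ.< k' → tri k ℕ.< tri k'
tri-mono {k} k<k' with ℕP.m≤n⇒∃[o]m+o≡n k<k'
... | m , eq = subst (λ t → tri k ℕ.< tri t) (trans (cong suc (ℕP.+-comm m k)) eq) (tri-strict k m)

k≤tri : ∀ k → k ℕ.≤ tri k
k≤tri zero    = ℕ.z≤n
k≤tri (suc k) = ℕP.<-≤-trans (ℕ.s≤s (k≤tri k)) (tri-step k)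

triSeries : ℕ → Series
triSeries zero    x = + 0
triSeries (suc L) x = triSeries L x + one (x - + tri L)

triSeries-power : ∀ L → IsPowerSeries (triSeries L)
triSeries-power zero    = powerSeries λ _ → refl
triSeries-power (suc L) = powerSeries λ m →
  cong₂ _+_ (negative-zero (triSeries-power L) m) (vanish one-power (shift-neg {a = + tri L} ℤP.≤-refl (ℤP.<-≤-trans ℤ.-<+ (ℤ.+≤+ ℕ.z≤n))))

one-shift-same : ∀ n → one (+ n - + n) ≡ + 1
one-shift-same n = cong one (ℤP.+-inverseʳ (+ n))

one-shift-other : ∀ n m → n ≢ m → one (+ n - + m) ≡ + 0
one-shift-other n m n≢m = off _ (λ eq → n≢m (ℤP.+-injective (ℤP.i-j≡0⇒i≡j (+ n) (+ m) eq)))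
  where
  off : ∀ y → y ≢ + 0 → one y ≡ + 0
  off (+ zero)  y≢0 = ⊥-elim (y≢0 refl)
  off (+ suc _) _   = refl
  off -[1+ _ ]  _   = refl

triSeries-miss : ∀ n L → (∀ k → k ℕ.< L → tri k ≢ n) → triSeries L (+ n) ≡ + 0
triSeries-miss n zero    _    = refl
triSeries-miss n (suc L) miss =
  cong₂ _+_ (triSeries-miss n L (λ k k<L → miss k (ℕP.m<n⇒m<1+n k<L)))
            (one-shift-other n (tri L) (λ eq → miss L (ℕP.n<1+n L) (sym eq)))

triSeries-hit : ∀ n k → tri k ≡ n → ∀ m → triSeries (suc (m ℕ.+ k)) (+ n) ≡ + 1
triSeries-hit n k refl zero    =
  cong₂ _+_ (triSeries-miss n k (λ k' k'<k eq → ℕP.<-irrefl eq (tri-mono k'<k))) (one-shift-same n)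
triSeries-hit n k refl (suc m) =
  cong₂ _+_ (triSeries-hit n k refl m) (one-shift-other n _ (λ eq → ℕP.<-irrefl eq (tri-strict k m)))

triangular-expo-pos : ∀ m → TriangularJTP.expo (+ suc m) ≡ + tri (suc (double m))
triangular-expo-pos m = trans (solved (+ m)) (sym (trans (cong +_ (tri-odd m)) cast))
  where
  solved : ∀ (M : ℤ) → + 6 * ((+ 1 + M) * (+ 1 + M - + 1)) + + 3 * (+ 1 + M) ≡ + 3 * ((+ 1 + M) * (+ 1 + + 2 * M))
  solved = solve-∀
  cast : + (3 ℕ.* (suc m ℕ.* suc (2 ℕ.* m))) ≡ + 3 * ((+ 1 + + m) * (+ 1 + + 2 * + m))
  cast = trans (ℤP.pos-* 3 (suc m ℕ.* suc (2 ℕ.* m))) (cong (+ 3 *_) (trans (ℤP.pos-* (suc m) (suc (2 ℕ.* m))) (cong (λ t → + suc m * (+ 1 + t)) (ℤP.pos-* 2 m))))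

triangular-expo-neg : ∀ m → TriangularJTP.expo -[1+ m ] ≡ + tri (suc (suc (double m)))
triangular-expo-neg m = trans (solved (+ m)) (sym (trans (cong +_ (tri-even m)) cast))
  where
  solved : ∀ (M : ℤ) → + 6 * (- (+ 1 + M) * (- (+ 1 + M) - + 1)) + + 3 * - (+ 1 + M) ≡ + 3 * ((+ 1 + M) * (+ 2 * M + + 3))
  solved = solve-∀
  cast : + (3 ℕ.* (suc m ℕ.* (2 ℕ.* m ℕ.+ 3))) ≡ + 3 * ((+ 1 + + m) * (+ 2 * + m + + 3))
  cast = trans (ℤP.pos-* 3 (suc m ℕ.* (2 ℕ.* m ℕ.+ 3))) (cong (+ 3 *_) (trans (ℤP.pos-* (suc m) (2 ℕ.* m ℕ.+ 3))
           (cong (+ suc m *_) (trans (ℤP.pos-+ (2 ℕ.* m) 3) (cong (_+ + 3) (ℤP.pos-* 2 m))))))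

triangular-upow : ∀ j → TriangularJTP.upow j ≡ + 1
triangular-upow j = ℤP.^-zeroˡ ℤ.∣ j ∣

triangular-theta : ∀ N → TriangularJTP.thetaSeries N ≈ triSeries (suc (double (suc N)))
triangular-theta N x = trans (symSum-pairs φ (suc N)) (pairs (suc N))
  where
  open TriangularJTP using (upow; expo)
  φ : ℤ → ℤ
  φ j = upow j * one (x - expo j)
  at : ∀ j k → expo j ≡ + k → φ j ≡ one (x - + k)
  at j k eq = trans (cong₂ _*_ (triangular-upow j) (cong (λ t → one (x - t)) eq)) (ℤP.*-identityˡ _)
  regroup : ∀ (a b c d : ℤ) → a + (b + (c + d)) ≡ (a + b) + c + d
  regroup = solve-∀
  pairs : ∀ R → φ (+ 0) + pairSum φ R ≡ triSeries (suc (double R)) x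
  pairs zero    = trans (ℤP.+-identityʳ _) (trans (at (+ 0) 0 TriangularJTP.expo-zero) (sym (ℤP.+-identityˡ _)))
  pairs (suc R) = begin
    φ (+ 0) + (pairSum φ R + (φ (+ suc R) + φ -[1+ R ]))
      ≡⟨ regroup (φ (+ 0)) (pairSum φ R) (φ (+ suc R)) (φ -[1+ R ]) ⟩
    φ (+ 0) + pairSum φ R + φ (+ suc R) + φ -[1+ R ]
      ≡⟨ cong₃ (pairs R) (at (+ suc R) _ (triangular-expo-pos R)) (at -[1+ R ] _ (triangular-expo-neg R)) ⟩
    triSeries (suc (suc (suc (double R)))) x ∎
    where
    cong₃ : ∀ {a a' b b' d d'} → a ≡ a' → b ≡ b' → d ≡ d' → a + b + d ≡ a' + b' + d'
    cong₃ refl refl refl = refl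

mulAll-↭ : ∀ {L M} → L ↭ M → ∀ f → mulAll L f ≈ mulAll M f
mulAll-↭ Perm.refl                         f = ≈-refl
mulAll-↭ (Perm.prep (e , a) L↭M)           f = mulBy-cong e a (mulAll-↭ L↭M f)
mulAll-↭ (Perm.swap {ys = M} (e , a) (e' , b) L↭M) f =
  ≈-trans (mulBy-cong e a (mulBy-cong e' b (mulAll-↭ L↭M f))) (mulBy-comm e a e' b (mulAll M f))
mulAll-↭ (Perm.trans L↭M M↭N)              f = ≈-trans (mulAll-↭ L↭M f) (mulAll-↭ M↭N f)

interleave₂ : ∀ {X : Set} (A A' B B' : List X) → (A ++ A') ++ (B ++ B') ↭ (A ++ B) ++ (A' ++ B')
interleave₂ A A' B B' =
  ↭-trans (↭-reflexive (ListP.++-assoc A A' (B ++ B')))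
  (↭-trans (PermP.++⁺ˡ A (PermP.shifts A' B))
           (↭-reflexive (sym (ListP.++-assoc A B (A' ++ B')))))

interleave₃ : ∀ {X : Set} (A A' B B' C C' : List X) →
              (A ++ A') ++ ((B ++ B') ++ (C ++ C')) ↭ (A ++ (B ++ C)) ++ (A' ++ (B' ++ C'))
interleave₃ A A' B B' C C' =
  ↭-trans (PermP.++⁺ˡ (A ++ A') (interleave₂ B B' C C')) (interleave₂ A A' (B ++ C) (B' ++ C'))

o p : ℕ → Factor
o a = (+ 1 , a)
p a = (- + 1 , a)

leftFactors rightFactors : ℕ → List Factor
leftFactors K = oddFactors (6 ℕ.* K) ++ (TriangularJTP.qPoch (double K) ++ TriangularJTP.tripleFactors K)
rightFactors K = SignedJTP.qPoch (double (double K)) ++ SignedJTP.tripleFactors (double K)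

leftBlock rightBlock : ℕ → List Factor
leftBlock k = o (12 ℕ.* k ℕ.+ 11) ∷ o (12 ℕ.* k ℕ.+ 9) ∷ o (12 ℕ.* k ℕ.+ 7) ∷ o (12 ℕ.* k ℕ.+ 5)
            ∷ o (12 ℕ.* k ℕ.+ 3) ∷ o (12 ℕ.* k ℕ.+ 1) ∷ o (24 ℕ.* k ℕ.+ 24) ∷ o (24 ℕ.* k ℕ.+ 12)
            ∷ p (12 ℕ.* k ℕ.+ 3) ∷ p (12 ℕ.* k ℕ.+ 9) ∷ []
rightBlock k = o (24 ℕ.* k ℕ.+ 24) ∷ o (24 ℕ.* k ℕ.+ 18) ∷ o (24 ℕ.* k ℕ.+ 12) ∷ o (24 ℕ.* k ℕ.+ 6)
             ∷ o (12 ℕ.* k ℕ.+ 7) ∷ o (12 ℕ.* k ℕ.+ 11) ∷ o (12 ℕ.* k ℕ.+ 1) ∷ o (12 ℕ.* k ℕ.+ 5) ∷ []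

-- The blocks agree: (1 - q^{12k+3})(1 + q^{12k+3}) = 1 - q^{24k+6} and
-- (1 - q^{12k+9})(1 + q^{12k+9}) = 1 - q^{24k+18}; the other factors are only reordered.
block-identity : ∀ k g → mulAll (leftBlock k) g ≈ mulAll (rightBlock k) g
block-identity k g =
  ≈-trans (mulAll-↭ gather g)
  (≈-trans (mulBy-square a₉ b₁₈ (mulAll (o a₃ ∷ p a₃ ∷ rest) g) (double-sum 9 18 k refl))
  (≈-trans (mulBy-cong (+ 1) b₁₈ (mulBy-square a₃ b₆ (mulAll rest g) (double-sum 3 6 k refl)))
           (mulAll-↭ (↭-sym spread) g)))
  where
  a₁ a₃ a₅ a₇ a₉ a₁₁ b₆ b₁₂ b₁₈ b₂₄ : ℕ
  a₁ = 12 ℕ.* k ℕ.+ 1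
  a₃ = 12 ℕ.* k ℕ.+ 3
  a₅ = 12 ℕ.* k ℕ.+ 5
  a₇ = 12 ℕ.* k ℕ.+ 7
  a₉ = 12 ℕ.* k ℕ.+ 9
  a₁₁ = 12 ℕ.* k ℕ.+ 11
  b₆ = 24 ℕ.* k ℕ.+ 6
  b₁₂ = 24 ℕ.* k ℕ.+ 12
  b₁₈ = 24 ℕ.* k ℕ.+ 18
  b₂₄ = 24 ℕ.* k ℕ.+ 24
  solved : ∀ r k → (12 ℕ.* k ℕ.+ r) ℕ.+ (12 ℕ.* k ℕ.+ r) ≡ 24 ℕ.* k ℕ.+ (r ℕ.+ r)
  solved = ℕSolver.solve-∀
  double-sum : ∀ r r' k → r ℕ.+ r ≡ r' → (12 ℕ.* k ℕ.+ r) ℕ.+ (12 ℕ.* k ℕ.+ r) ≡ 24 ℕ.* k ℕ.+ r'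
  double-sum r _ k refl = solved r k
  rest : List Factor
  rest = o a₁₁ ∷ o a₇ ∷ o a₅ ∷ o a₁ ∷ o b₂₄ ∷ o b₁₂ ∷ []
  gather : leftBlock k ↭ o a₉ ∷ p a₉ ∷ o a₃ ∷ p a₃ ∷ rest
  gather = ↭-begin
    o a₁₁ ∷ o a₉ ∷ o a₇ ∷ o a₅ ∷ o a₃ ∷ o a₁ ∷ o b₂₄ ∷ o b₁₂ ∷ p a₃ ∷ p a₉ ∷ []
      ↭⟨ PermP.shift (o a₉) (o a₁₁ ∷ []) _ ⟩
    o a₉ ∷ o a₁₁ ∷ o a₇ ∷ o a₅ ∷ o a₃ ∷ o a₁ ∷ o b₂₄ ∷ o b₁₂ ∷ p a₃ ∷ p a₉ ∷ []
      ↭⟨ Perm.prep (o a₉) (PermP.shift (p a₉) (o a₁₁ ∷ o a₇ ∷ o a₅ ∷ o a₃ ∷ o a₁ ∷ o b₂₄ ∷ o b₁₂ ∷ p a₃ ∷ []) []) ⟩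
    o a₉ ∷ p a₉ ∷ o a₁₁ ∷ o a₇ ∷ o a₅ ∷ o a₃ ∷ o a₁ ∷ o b₂₄ ∷ o b₁₂ ∷ p a₃ ∷ []
      ↭⟨ Perm.prep (o a₉) (Perm.prep (p a₉) (PermP.shift (o a₃) (o a₁₁ ∷ o a₇ ∷ o a₅ ∷ []) _)) ⟩
    o a₉ ∷ p a₉ ∷ o a₃ ∷ o a₁₁ ∷ o a₇ ∷ o a₅ ∷ o a₁ ∷ o b₂₄ ∷ o b₁₂ ∷ p a₃ ∷ []
      ↭⟨ Perm.prep (o a₉) (Perm.prep (p a₉) (Perm.prep (o a₃) (PermP.shift (p a₃) rest []))) ⟩
    o a₉ ∷ p a₉ ∷ o a₃ ∷ p a₃ ∷ rest ↭-∎
    where open Perm.PermutationReasoning using (step-↭-⟩) renaming (begin_ to ↭-begin_; _∎ to _↭-∎)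
  spread : rightBlock k ↭ o b₁₈ ∷ o b₆ ∷ rest
  spread = ↭-begin
    o b₂₄ ∷ o b₁₈ ∷ o b₁₂ ∷ o b₆ ∷ o a₇ ∷ o a₁₁ ∷ o a₁ ∷ o a₅ ∷ []
      ↭⟨ PermP.shift (o b₁₈) (o b₂₄ ∷ []) _ ⟩
    o b₁₈ ∷ o b₂₄ ∷ o b₁₂ ∷ o b₆ ∷ o a₇ ∷ o a₁₁ ∷ o a₁ ∷ o a₅ ∷ []
      ↭⟨ Perm.prep (o b₁₈) (PermP.shift (o b₆) (o b₂₄ ∷ o b₁₂ ∷ []) _) ⟩
    o b₁₈ ∷ o b₆ ∷ o b₂₄ ∷ o b₁₂ ∷ o a₇ ∷ o a₁₁ ∷ o a₁ ∷ o a₅ ∷ []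
      ↭⟨ Perm.prep (o b₁₈) (Perm.prep (o b₆) (PermP.shift (o a₁₁) (o b₂₄ ∷ o b₁₂ ∷ o a₇ ∷ []) _)) ⟩
    o b₁₈ ∷ o b₆ ∷ o a₁₁ ∷ o b₂₄ ∷ o b₁₂ ∷ o a₇ ∷ o a₁ ∷ o a₅ ∷ []
      ↭⟨ Perm.prep (o b₁₈) (Perm.prep (o b₆) (Perm.prep (o a₁₁) (PermP.shift (o a₇) (o b₂₄ ∷ o b₁₂ ∷ []) _))) ⟩
    o b₁₈ ∷ o b₆ ∷ o a₁₁ ∷ o a₇ ∷ o b₂₄ ∷ o b₁₂ ∷ o a₁ ∷ o a₅ ∷ []
      ↭⟨ Perm.prep (o b₁₈) (Perm.prep (o b₆) (Perm.prep (o a₁₁) (Perm.prep (o a₇)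
           (PermP.shift (o a₅) (o b₂₄ ∷ o b₁₂ ∷ o a₁ ∷ []) [])))) ⟩
    o b₁₈ ∷ o b₆ ∷ o a₁₁ ∷ o a₇ ∷ o a₅ ∷ o b₂₄ ∷ o b₁₂ ∷ o a₁ ∷ []
      ↭⟨ Perm.prep (o b₁₈) (Perm.prep (o b₆) (Perm.prep (o a₁₁) (Perm.prep (o a₇) (Perm.prep (o a₅)
           (PermP.shift (o a₁) (o b₂₄ ∷ o b₁₂ ∷ []) [])))))  ⟩
    o b₁₈ ∷ o b₆ ∷ rest ↭-∎
    where open Perm.PermutationReasoning using (step-↭-⟩) renaming (begin_ to ↭-begin_; _∎ to _↭-∎)

oddFactors-step : ∀ k → oddFactors (6 ℕ.* suc k)
                      ≡ o (12 ℕ.* k ℕ.+ 11) ∷ o (12 ℕ.* k ℕ.+ 9) ∷ o (12 ℕ.* k ℕ.+ 7) ∷ o (12 ℕ.* k ℕ.+ 5)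
                      ∷ o (12 ℕ.* k ℕ.+ 3) ∷ o (12 ℕ.* k ℕ.+ 1) ∷ oddFactors (6 ℕ.* k)
oddFactors-step k = trans (cong oddFactors (ℕP.*-suc 6 k))
  (cong₂ _∷_ (cong o (odd 5 k)) (cong₂ _∷_ (cong o (odd 4 k)) (cong₂ _∷_ (cong o (odd 3 k))
  (cong₂ _∷_ (cong o (odd 2 k)) (cong₂ _∷_ (cong o (odd 1 k)) (cong₂ _∷_ (cong o (odd 0 k)) refl))))))
  where
  odd : ∀ r k → 2 ℕ.* (r ℕ.+ 6 ℕ.* k) ℕ.+ 1 ≡ 12 ℕ.* k ℕ.+ (2 ℕ.* r ℕ.+ 1)
  odd = ℕSolver.solve-∀

triangular-qPoch-step : ∀ k → TriangularJTP.qPoch (double (suc k))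
                            ≡ o (24 ℕ.* k ℕ.+ 24) ∷ o (24 ℕ.* k ℕ.+ 12) ∷ TriangularJTP.qPoch (double k)
triangular-qPoch-step k = cong₂ _∷_ (cong o (top k (double k) (double-+ k))) (cong₂ _∷_ (cong o (next k (double k) (double-+ k))) refl)
  where
  top-solved : ∀ k → 12 ℕ.* suc (suc (k ℕ.+ k)) ≡ 24 ℕ.* k ℕ.+ 24
  top-solved = ℕSolver.solve-∀
  top : ∀ k D → D ≡ k ℕ.+ k → 12 ℕ.* suc (suc D) ≡ 24 ℕ.* k ℕ.+ 24
  top k _ refl = top-solved k
  next-solved : ∀ k → 12 ℕ.* suc (k ℕ.+ k) ≡ 24 ℕ.* k ℕ.+ 12
  next-solved = ℕSolver.solve-∀
  next : ∀ k D → D ≡ k ℕ.+ k → 12 ℕ.* suc D ≡ 24 ℕ.* k ℕ.+ 12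
  next k _ refl = next-solved k

triangular-triple-step : ∀ k → TriangularJTP.tripleFactors (suc k)
                             ≡ p (12 ℕ.* k ℕ.+ 3) ∷ p (12 ℕ.* k ℕ.+ 9) ∷ TriangularJTP.tripleFactors k
triangular-triple-step k = cong₂ _∷_ (cong p (ℕP.+-comm 3 (12 ℕ.* k))) (cong₂ _∷_ (cong p (ℕP.+-comm 9 (12 ℕ.* k))) refl)

signed-qPoch-step : ∀ k → SignedJTP.qPoch (double (double (suc k)))
                        ≡ o (24 ℕ.* k ℕ.+ 24) ∷ o (24 ℕ.* k ℕ.+ 18) ∷ o (24 ℕ.* k ℕ.+ 12) ∷ o (24 ℕ.* k ℕ.+ 6)
                        ∷ SignedJTP.qPoch (double (double k))
signed-qPoch-step k =
  cong₂ _∷_ (cong o (sixfold 4 k)) (cong₂ _∷_ (cong o (sixfold 3 k)) (cong₂ _∷_ (cong o (sixfold 2 k))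
  (cong₂ _∷_ (cong o (sixfold 1 k)) refl)))
  where
  quadruple : ∀ k → double (double k) ≡ 4 ℕ.* k
  quadruple k = trans (double-+ (double k)) (trans (cong₂ ℕ._+_ (double-+ k) (double-+ k)) (four k))
    where
    four : ∀ k → (k ℕ.+ k) ℕ.+ (k ℕ.+ k) ≡ 4 ℕ.* k
    four = ℕSolver.solve-∀
  solved : ∀ r k → 6 ℕ.* (r ℕ.+ 4 ℕ.* k) ≡ 24 ℕ.* k ℕ.+ 6 ℕ.* r
  solved = ℕSolver.solve-∀
  sixfold : ∀ r k → 6 ℕ.* (r ℕ.+ double (double k)) ≡ 24 ℕ.* k ℕ.+ 6 ℕ.* r
  sixfold r k = trans (cong (λ D → 6 ℕ.* (r ℕ.+ D)) (quadruple k)) (solved r k)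

signed-triple-step : ∀ k → SignedJTP.tripleFactors (double (suc k))
                         ≡ o (12 ℕ.* k ℕ.+ 7) ∷ o (12 ℕ.* k ℕ.+ 11) ∷ o (12 ℕ.* k ℕ.+ 1) ∷ o (12 ℕ.* k ℕ.+ 5)
                         ∷ SignedJTP.tripleFactors (double k)
signed-triple-step k =
  cong₂ _∷_ (cong o (upper 1 k)) (cong₂ _∷_ (cong o (upper 5 k))
  (cong₂ _∷_ (cong o (lower 1 k)) (cong₂ _∷_ (cong o (lower 5 k)) refl)))
  where
  upper-solved : ∀ c k → c ℕ.+ 6 ℕ.* suc (k ℕ.+ k) ≡ 12 ℕ.* k ℕ.+ (c ℕ.+ 6)
  upper-solved = ℕSolver.solve-∀
  upper : ∀ c k → c ℕ.+ 6 ℕ.* suc (double k) ≡ 12 ℕ.* k ℕ.+ (c ℕ.+ 6)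
  upper c k = trans (cong (λ D → c ℕ.+ 6 ℕ.* suc D) (double-+ k)) (upper-solved c k)
  lower-solved : ∀ c k → c ℕ.+ 6 ℕ.* (k ℕ.+ k) ≡ 12 ℕ.* k ℕ.+ c
  lower-solved = ℕSolver.solve-∀
  lower : ∀ c k → c ℕ.+ 6 ℕ.* double k ≡ 12 ℕ.* k ℕ.+ c
  lower c k = trans (cong (λ D → c ℕ.+ 6 ℕ.* D) (double-+ k)) (lower-solved c k)

left-step : ∀ k → leftFactors (suc k) ↭ leftBlock k ++ leftFactors k
left-step k =
  ↭-trans (↭-reflexive (cong₂ _++_ (oddFactors-step k)
                                   (cong₂ _++_ (triangular-qPoch-step k) (triangular-triple-step k))))
          (interleave₃ (o (12 ℕ.* k ℕ.+ 11) ∷ o (12 ℕ.* k ℕ.+ 9) ∷ o (12 ℕ.* k ℕ.+ 7) ∷ o (12 ℕ.* k ℕ.+ 5)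
                          ∷ o (12 ℕ.* k ℕ.+ 3) ∷ o (12 ℕ.* k ℕ.+ 1) ∷ [])
                       (oddFactors (6 ℕ.* k))
                       (o (24 ℕ.* k ℕ.+ 24) ∷ o (24 ℕ.* k ℕ.+ 12) ∷ []) (TriangularJTP.qPoch (double k))
                       (p (12 ℕ.* k ℕ.+ 3) ∷ p (12 ℕ.* k ℕ.+ 9) ∷ []) (TriangularJTP.tripleFactors k))

right-step : ∀ k → rightFactors (suc k) ↭ rightBlock k ++ rightFactors k
right-step k =
  ↭-trans (↭-reflexive (cong₂ _++_ (signed-qPoch-step k) (signed-triple-step k)))
          (interleave₂ (o (24 ℕ.* k ℕ.+ 24) ∷ o (24 ℕ.* k ℕ.+ 18) ∷ o (24 ℕ.* k ℕ.+ 12) ∷ o (24 ℕ.* k ℕ.+ 6) ∷ [])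
                       (SignedJTP.qPoch (double (double k)))
                       (o (12 ℕ.* k ℕ.+ 7) ∷ o (12 ℕ.* k ℕ.+ 11) ∷ o (12 ℕ.* k ℕ.+ 1) ∷ o (12 ℕ.* k ℕ.+ 5) ∷ [])
                       (SignedJTP.tripleFactors (double k)))

product-identity : ∀ K f → mulAll (leftFactors K) f ≈ mulAll (rightFactors K) f
product-identity zero    f = ≈-refl
product-identity (suc k) f =
  ≈-trans (mulAll-↭ (left-step k) f)
  (≈-trans (mulAll-++ (leftBlock k) (leftFactors k) f)
  (≈-trans (mulAll-cong (leftBlock k) (product-identity k f))
  (≈-trans (block-identity k (mulAll (rightFactors k) f))
  (≈-trans (≈-sym (mulAll-++ (rightBlock k) (rightFactors k) f))
           (mulAll-↭ (↭-sym (right-step k)) f)))))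

-- Up to degree n, with K = 2n + 1:
--   ∏_{i<6K} (1 - q^{2i+1}) · θ_{2K+1}(q) Σₘ p_o(m) qᵐ
--     = (q⁶; q⁶)_{4K} ∏_{i<2K} (1 - q^{6i+1}) (1 - q^{6i+5})                    (Euler, SignedJTP)
--     = ∏_{i<6K} (1 - q^{2i+1}) · (q¹²; q¹²)_{2K} ∏_{i<K} (1 + q^{12i+3}) (1 + q^{12i+9})
--     = ∏_{i<6K} (1 - q^{2i+1}) · Σ_k q^{3k(k+1)/2}                              (TriangularJTP),
-- and the common factor cancels.
theta-po-triangular : ∀ n → mulTheta (suc (double (suc (double n)))) poℤ
                            ≈[ + n ] TriangularJTP.thetaSeries (suc (double n))
theta-po-triangular n =
  mulAll-cancel (oddFactors-cancellable (6 ℕ.* K)) (+ n) (mulTheta-power R po-power) triangular-power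
    (≈[]-trans (≈⇒≈[] _ (mulAll-mulTheta X R poℤ))
    (≈[]-trans (mulTheta-cong[] R (≈[]-mono n≤2b+1 X-po))
    (≈[]-trans (≈⇒≈[] _ (mulTheta-one (double K)))
    (≈[]-trans (≈[]-sym (SignedJTP.triple-truncated (double K) n 2n≤2K))
    (≈[]-trans (≈⇒≈[] _ (≈-sym (mulAll-++ (SignedJTP.qPoch (double (double K))) (SignedJTP.tripleFactors (double K)) one)))
    (≈[]-trans (≈⇒≈[] _ (≈-sym (product-identity K one)))
    (≈[]-trans (≈⇒≈[] _ (≈-trans (mulAll-++ X _ one) (mulAll-cong X (mulAll-++ (TriangularJTP.qPoch (double K)) _ one))))
               (mulAll-cong[] X (TriangularJTP.triple-truncated K n 2n≤K)))))))))
  where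
  K R b : ℕ
  X : List Factor
  K = suc (double n)
  R = suc (double K)
  X = oddFactors (6 ℕ.* K)
  b = 5 ℕ.+ 6 ℕ.* double n
  2n≤K : n ℕ.+ n ℕ.≤ K
  2n≤K = ℕP.≤-trans (ℕP.≤-reflexive (sym (double-+ n))) (ℕP.n≤1+n (double n))
  2n≤2K : n ℕ.+ n ℕ.≤ double K
  2n≤2K = ℕP.≤-trans 2n≤K (n≤double K)
  n≤2b+1 : + n ≤ + (2 ℕ.* b ℕ.+ 1)
  n≤2b+1 = ℤ.+≤+ (ℕP.≤-trans (n≤double n) (ℕP.≤-trans (ℕP.m≤n+m (double n) (11 ℕ.+ 11 ℕ.* double n))
                                                     (ℕP.≤-reflexive (expand (double n)))))
    where
    expand : ∀ D → (11 ℕ.+ 11 ℕ.* D) ℕ.+ D ≡ 2 ℕ.* (5 ℕ.+ 6 ℕ.* D) ℕ.+ 1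
    expand = ℕSolver.solve-∀
  X-po : mulAll X poℤ ≈[ + (2 ℕ.* b ℕ.+ 1) ] one
  X-po = subst (λ m → mulAll (oddFactors m) poℤ ≈[ + (2 ℕ.* b ℕ.+ 1) ] one) (sym (ℕP.*-suc 6 (double n))) (oddFactors-po b)
  triangular-power : IsPowerSeries (TriangularJTP.thetaSeries K)
  triangular-power = powerSeries λ m → trans (triangular-theta K -[1+ m ]) (negative-zero (triSeries-power (suc (double (suc K)))) m)

lhs-triSeries : ∀ n → lhs n ≡ triSeries (suc (double (suc (suc (double n))))) (+ n)
lhs-triSeries n = begin
  lhs n                                               ≡⟨ lhs-mulTheta n ⟩
  mulTheta (suc n) poℤ (+ n)                          ≡⟨ sym (mulTheta-range po-power n (suc n) R (ℕP.n<1+n n) n<R (+ n) ℤP.≤-refl) ⟩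
  mulTheta R poℤ (+ n)                                ≡⟨ theta-po-triangular n (+ n) ℤP.≤-refl ⟩
  TriangularJTP.thetaSeries (suc (double n)) (+ n)    ≡⟨ triangular-theta (suc (double n)) (+ n) ⟩
  triSeries (suc (double (suc (suc (double n))))) (+ n) ∎
  where
  R : ℕ
  R = suc (double (suc (double n)))
  n<R : suc n ℕ.≤ R
  n<R = ℕ.s≤s (ℕP.≤-trans (ℕP.≤-trans (n≤double n) (ℕP.n≤1+n (double n))) (n≤double (suc (double n))))

theorem3p6 : (n : ℕ) → (IsThreeTri n → lhs n ≡ + 1) × (¬ IsThreeTri n → lhs n ≡ + 0)
theorem3p6 n = triangular , not-triangular
  where
  L : ℕ
  L = double (suc (suc (double n)))
  n≤L : n ℕ.≤ L
  n≤L = ℕP.≤-trans (n≤double n) (ℕP.≤-trans (ℕP.m≤n+m (double n) 2) (n≤double (suc (suc (double n)))))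
  tri≡ : ∀ k → 2 ℕ.* n ≡ 3 ℕ.* (k ℕ.* suc k) → tri k ≡ n
  tri≡ k eq = ℕP.*-cancelˡ-≡ (tri k) n 2 (trans (tri-closed k) (sym eq))
  triangular : IsThreeTri n → lhs n ≡ + 1
  triangular (k , eq) = begin
    lhs n                                  ≡⟨ lhs-triSeries n ⟩
    triSeries (suc L) (+ n)                ≡⟨ cong (λ l → triSeries (suc l) (+ n)) (sym (ℕP.m∸n+n≡m k≤L)) ⟩
    triSeries (suc (L ℕ.∸ k ℕ.+ k)) (+ n)  ≡⟨ triSeries-hit n k (tri≡ k eq) (L ℕ.∸ k) ⟩
    + 1                                    ∎
    where
    k≤L : k ℕ.≤ L
    k≤L = ℕP.≤-trans (k≤tri k) (subst (ℕ._≤ L) (sym (tri≡ k eq)) n≤L)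
  not-triangular : ¬ IsThreeTri n → lhs n ≡ + 0
  not-triangular ¬tri = trans (lhs-triSeries n)
    (triSeries-miss n (suc L) λ k _ tri-k≡n → ¬tri (k , trans (cong (2 ℕ.*_) (sym tri-k≡n)) (tri-closed k)))
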